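{- Let $S,T$ be numberings of shape $\lambda\vdash n$, let $1\le i\le \ell(\lambda)-1$, and let $Q$ be a nonempty subset of the entries in row $i+1$ of $S$. Let $\Xi_{i,Q}(S)$ be the set of all numberings $U$ obtained from $S$ by exchanging a (possibly empty) subset of $Q$ with a subset of the same size of the entries of row $i$ of $S$, preserving the order of each subset of elements. Define $\gamma_Q^T(S)=\sum_{U\in\Xi_{i,Q}(S)}\sigma_{U,T}\,a_U$. Then $\gamma_Q^T(S)\in\ker\Psi^T$.
   Context: A numbering of shape $\lambda\vdash n$ is a filling of the Ferrers diagram of $\lambda$ (English convention) with $1,\dots,n$ each used once; $\ell(\lambda)$ is the number of rows. $\mathfrak{S}_n$ acts by $(\pi\cdot T)(i,j)=\pi(T(i,j))$; products in $\mathbb{C}[\mathfrak{S}_n]$ are composition. For numberings $S,T$ of the same shape, $\sigma_{T,S}$ is the unique permutation with $\sigma_{T,S}\cdot T=S$. $R(T)$ (resp. $C(T)$) is the subgroup preserving the set of entries of each row (resp. column) of $T$; $a_T=\sum_{\rho\in R(T)}\rho$, $b_T=\sum_{\zeta\in C(T)}\mathrm{sgn}(\zeta)\zeta$. Let $\widetilde{\mathcal{M}}^T=a_T\,\mathbb{C}[\mathfrak{S}_n]$ be the right $\mathfrak{S}_n$-submodule of $\mathbb{C}[\mathfrak{S}_n]$ generated by $a_T$ (note $\sigma_{U,T}a_U=a_T\sigma_{U,T}\in\widetilde{\mathcal{M}}^T$), and let $\Psi^T:\widetilde{\mathcal{M}}^T\to\mathbb{C}[\mathfrak{S}_n]$ be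 the right $\mathfrak{S}_n$-module homomorphism with $\Psi^T(a_Tx)=b_Ta_Tx$. -}

module Defs where

open import Data.Nat as ℕ using (ℕ; zero; suc; _<_; _≥_)
open import Data.Integer as ℤ using (ℤ; 0ℤ; 1ℤ; -1ℤ)
open import Data.Fin as Fin using (Fin; toℕ)
open import Data.Fin.Properties as FinP using (all?)
open import Data.Fin.Subset using (Subset; _∈_; _⊆_; ∣_∣; Nonempty)
open import Data.Fin.Subset.Properties using (_⊆?_; _∈?_)
open import Data.Fin.Permutation as Perm using (Permutation′; _⟨$⟩ʳ_; _⟨$⟩ˡ_; _∘ₚ_; transpose; inverseˡ; inverseʳ)
open import Data.Bool using (Bool; true; false)
open import Data.List as List using (List; []; _∷_; map; concatMap; filter; length; lookup; allFin; zip; foldr; _++_)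
open import Data.Nat.ListAction using (sum)
open import Data.List.Relation.Unary.All using (All)
open import Data.List.Relation.Unary.Linked using (Linked)
open import Data.Vec as Vec using (Vec; tabulate) renaming (lookup to vlookup)
open import Data.Vec.Properties using (≡-dec)
open import Data.Product using (Σ; Σ-syntax; _×_; _,_; proj₁; proj₂)
open import Function using (_∘_)
open import Relation.Nullary using (Dec; yes; no; ¬_)
open import Relation.Nullary.Decidable using (⌊_⌋)
open import Data.Empty using (⊥-elim)
open import Relation.Binary.PropositionalEquality using (_≡_; refl; cong; trans)

record Partition (n : ℕ) : Set where
  field
    parts    : List ℕ
    sums     : sum parts ≡ n
    positive : All (0 <_) parts
    weakDecr : Linked _≥_ parts

open Partition public

ℓ : ∀ {n} → Partition n → ℕ
ℓ λ′ = length (parts λ′)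

-- cells of the Ferrers diagram: (row r, column c) with c < λ_r  (0-based)
Cell : ∀ {n} → Partition n → Set
Cell λ′ = Σ[ r ∈ Fin (ℓ λ′) ] Fin (lookup (parts λ′) r)

-- a numbering: a bijection between cells and {1..n} (here Fin n)
record Numbering {n : ℕ} (λ′ : Partition n) : Set where
  field
    entry     : Cell λ′ → Fin n
    pos       : Fin n → Cell λ′
    pos-entry : ∀ c → pos (entry c) ≡ c
    entry-pos : ∀ k → entry (pos k) ≡ k

open Numbering public

rowOf : ∀ {n} {λ′ : Partition n} → Numbering λ′ → Fin n → Fin (ℓ λ′)
rowOf T k = proj₁ (pos T k)

colOf : ∀ {n} {λ′ : Partition n} → Numbering λ′ → Fin n → ℕ
colOf T k = toℕ (proj₂ (pos T k))

_·_ : ∀ {n} {λ′ : Partition n} → Permutation′ n → Numbering λ′ → Numbering λ′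
_·_ {λ′ = λ′} π T = record
  { entry     = λ c → π ⟨$⟩ʳ entry T c
  ; pos       = λ k → pos T (π ⟨$⟩ˡ k)
  ; pos-entry = λ c → trans (cong (pos T) (inverseˡ π)) (pos-entry T c)
  ; entry-pos = λ k → trans (cong (π ⟨$⟩ʳ_) (entry-pos T (π ⟨$⟩ˡ k))) (inverseʳ π)
  }

-- The symmetric group S_n as the tables of bijections Fin n → Fin n
-- (a permutation π is stored as the vector (π 0, …, π (n-1))).

Tab : ℕ → Set
Tab n = Vec (Fin n) n

_∘t_ : ∀ {n} → Tab n → Tab n → Tab n
π ∘t τ = tabulate (λ k → vlookup π (vlookup τ k))

IsPerm : ∀ {n} → Tab n → Set
IsPerm {n} v = ∀ (i j : Fin n) → vlookup v i ≡ vlookup v j → i ≡ j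

impl? : ∀ {n} (v : Tab n) (i j : Fin n) → Dec (vlookup v i ≡ vlookup v j → i ≡ j)
impl? v i j with vlookup v i FinP.≟ vlookup v j | i FinP.≟ j
... | _      | yes i≡j = yes (λ _ → i≡j)
... | no ne  | no _    = yes (λ e → ⊥-elim (ne e))
... | yes e  | no ni   = no (λ f → ni (f e))

isPerm? : ∀ {n} (v : Tab n) → Dec (IsPerm v)
isPerm? v = all? (λ i → all? (λ j → impl? v i j))

allVecs : ∀ {n} (m : ℕ) → List (Vec (Fin n) m)
allVecs zero    = Vec.[] ∷ []
allVecs {n} (suc m) = concatMap (λ x → map (x Vec.∷_) (allVecs m)) (allFin n)

Sym : (n : ℕ) → List (Tab n)
Sym n = filter isPerm? (allVecs n)

inversions : ∀ {n} → Tab n → ℕ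
inversions {n} v = List.length
  (filter (λ (p : Fin n × Fin n) → (proj₁ p Fin.<? proj₂ p) ×-dec (vlookup v (proj₂ p) Fin.<? vlookup v (proj₁ p)))
          (List.cartesianProduct (allFin n) (allFin n)))
  where open import Relation.Nullary.Decidable using (_×-dec_)

sgn : ∀ {n} → Tab n → ℤ
sgn v = (-1ℤ) ℤ.^ inversions v

table : ∀ {n} → Permutation′ n → Tab n
table π = tabulate (π ⟨$⟩ʳ_)

-- The group ring ℤ[S_n] as formal integer combinations of permutations,
-- compared coefficientwise.

GA : ℕ → Set
GA n = List (ℤ × Tab n)

coeff : ∀ {n} → GA n → Tab n → ℤ
coeff [] v = 0ℤ
coeff ((c , τ) ∷ xs) v with ≡-dec FinP._≟_ τ v
... | yes _ = c ℤ.+ coeff xs v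
... | no  _ = coeff xs v

infix 4 _≈_
_≈_ : ∀ {n} → GA n → GA n → Set
x ≈ y = ∀ v → coeff x v ≡ coeff y v

0G : ∀ {n} → GA n
0G = []

_*_ : ∀ {n} → GA n → GA n → GA n
x * y = concatMap (λ p → map (λ q → (proj₁ p ℤ.* proj₁ q , proj₂ p ∘t proj₂ q)) y) x

⟦_⟧ : ∀ {n} → Tab n → GA n
⟦ g ⟧ = (1ℤ , g) ∷ []

module _ {n : ℕ} {λ′ : Partition n} (T : Numbering λ′) where

  InR : Tab n → Set
  InR ρ = ∀ k → rowOf T (vlookup ρ k) ≡ rowOf T k

  InC : Tab n → Set
  InC ζ = ∀ k → colOf T (vlookup ζ k) ≡ colOf T k

  R : List (Tab n)
  R = filter (λ ρ → all? (λ k → rowOf T (vlookup ρ k) FinP.≟ rowOf T k)) (Sym n)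

  C : List (Tab n)
  C = filter (λ ζ → all? (λ k → colOf T (vlookup ζ k) ℕ.≟ colOf T k)) (Sym n)

  a : GA n
  a = map (λ ρ → (1ℤ , ρ)) R

  b : GA n
  b = map (λ ζ → (sgn ζ , ζ)) C

-- σ_{T,S}: the permutation with σ_{T,S} · T = S, i.e. σ(T c) = S c
σ : ∀ {n} {λ′ : Partition n} → Numbering λ′ → Numbering λ′ → Tab n
σ T S = tabulate (λ k → entry S (pos T k))

-- y lies in M̃^T = a_T ℤ[S_n] and Ψ^T(y) = 0, where Ψ^T(a_T x) = b_T a_T x
InKerΨ : ∀ {n} {λ′ : Partition n} → Numbering λ′ → GA n → Set
InKerΨ {n} T y = Σ[ x ∈ GA n ] ((y ≈ a T * x) × (b T * (a T * x) ≈ 0G))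

allSubsets : (n : ℕ) → List (Subset n)
allSubsets zero    = Vec.[] ∷ []
allSubsets (suc n) = concatMap (λ b → map (b Vec.∷_) (allSubsets n)) (true ∷ false ∷ [])

rowEntries : ∀ {n} {λ′ : Partition n} → Numbering λ′ → Fin (ℓ λ′) → List (Fin n)
rowEntries S r = map (λ c → entry S (r , c)) (allFin _)

-- the set of entries of the row with (0-based) index i
InRow : ∀ {n} {λ′ : Partition n} → Numbering λ′ → ℕ → Subset n → Set
InRow S i A = ∀ k → k ∈ A → toℕ (rowOf S k) ≡ i

inRow? : ∀ {n} {λ′ : Partition n} (S : Numbering λ′) (i : ℕ) (A : Subset n) → Dec (InRow S i A)
inRow? S i A = all? (λ k → impl k)
  where
  impl : ∀ k → Dec (k ∈ A → toℕ (rowOf S k) ≡ i)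
  impl k with k ∈? A | toℕ (rowOf S k) ℕ.≟ i
  ... | _     | yes e = yes (λ _ → e)
  ... | no k∉ | no _  = yes (λ k∈ → ⊥-elim (k∉ k∈))
  ... | yes k∈ | no ne = no (λ f → ne (f k∈))

ordered : ∀ {n} {λ′ : Partition n} → Numbering λ′ → ℕ → Subset n → List (Fin n)
ordered {λ′ = λ′} S i A = concatMap (λ r → if ⌊ toℕ r ℕ.≟ i ⌋ then filter (_∈? A) (rowEntries S r) else []) (allFin (ℓ λ′))
  where open import Data.Bool using (if_then_else_)

swaps : ∀ {n} → List (Fin n × Fin n) → Permutation′ n
swaps []             = Perm.id
swaps ((x , y) ∷ ps) = transpose x y ∘ₚ swaps ps

-- U obtained from S by exchanging A ⊆ row i+1 with B ⊆ row i (|A| = |B|),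
-- the j-th element of A (left to right) moving to the place of the j-th
-- element of B and vice versa
exchange : ∀ {n} {λ′ : Partition n} → Numbering λ′ → ℕ → Subset n → Subset n → Numbering λ′
exchange S i A B = swaps (zip (ordered S (suc i) A) (ordered S i B)) · S

ΞIndex : ∀ {n} {λ′ : Partition n} → Numbering λ′ → ℕ → Subset n → List (Subset n × Subset n)
ΞIndex {n} S i Q =
  filter (λ p → ∣ proj₁ p ∣ ℕ.≟ ∣ proj₂ p ∣)
    (List.cartesianProduct (filter (_⊆? Q) (allSubsets n))
                           (filter (inRow? S i) (allSubsets n)))

Ξ : ∀ {n} {λ′ : Partition n} → Numbering λ′ → ℕ → Subset n → List (Numbering λ′)
Ξ S i Q = map (λ p → exchange S i (proj₁ p) (proj₂ p)) (ΞIndex S i Q)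

γ : ∀ {n} {λ′ : Partition n} → Numbering λ′ → Numbering λ′ → ℕ → Subset n → GA n
γ T S i Q = concatMap (λ U → ⟦ σ U T ⟧ * a U) (Ξ S i Q)

module Submission where

-- Since σ_{U,T} a_U = a_T σ_{U,T}, the element γ equals a_T x for x = Σ_U σ_{U,T}, and it remains
-- to show b_T γ = 0.  The coefficient of γ at a permutation u counts the exchanges (A, B) that put
-- every entry k into the row of T containing u(k).  Composing u with the transposition τ of two
-- entries x, y of one column of T, in rows i and i+1 and both images under u of Q ∪ (row i of S),
-- only renames two positions of Q ∪ (row i of S), so this count is unchanged, while b_T (w τ) = - b_T w.
-- Hence the terms b_T(w) γ(u) of b_T γ cancel in pairs under (w, u) ↦ (w τ, τ u), with τ chosen
-- canonically from u.  If no such τ exists then γ(u) = 0: an exchange moves some entry of Q ∪ (row i)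
-- to row i+1 of T, and since row i is at least as long as row i+1 the cell above it yields a τ.

open import Defs
open import Data.Bool using (Bool; true; false; if_then_else_; _∧_; _∨_; not)
import Data.Bool.Properties as BoolP
open import Data.Empty using (⊥; ⊥-elim)
open import Data.Fin as Fin using (Fin; zero; suc; toℕ)
open import Data.Fin.Permutation using (_⟨$⟩ˡ_)
import Data.Fin.Permutation.Components as PC
import Data.Fin.Properties as FinP
open import Data.Fin.Properties using (all?)
open import Data.Fin.Subset using (Subset; _∈_; _⊆_; ∣_∣; Nonempty)
open import Data.Fin.Subset.Properties using (_∈?_; _⊆?_; ⊆-antisym; nonempty?; Empty-unique; ∣⊥∣≡0; x∈p⇒∣p-x∣<∣p∣)
open import Data.Integer as ℤ using (ℤ; 0ℤ; 1ℤ; -1ℤ; +_; -_; -[1+_]; _+_)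
open import Data.Integer.Properties
open import Data.Integer.Tactic.RingSolver using (solve-∀)
open import Algebra.Properties.AbelianGroup +-0-abelianGroup using (∙-cancelˡ; ∙-cancelʳ)
open import Data.List as List using (List; []; _∷_; map; concatMap; filter; _++_; cartesianProduct; allFin; tabulate; zip)
open import Data.List.Membership.Propositional using () renaming (_∈_ to _∈ₗ_)
open import Data.List.Membership.Propositional.Properties using (∈-cartesianProduct⁺; ∈-allFin)
open import Data.List.Relation.Unary.Any using (here; there)
open import Data.List.Relation.Unary.Linked using (Linked; _∷_)
open import Data.Maybe using (Maybe; just; nothing)
open import Data.Maybe.Properties using (just-injective)
open import Data.Nat as ℕ using (ℕ; suc; _<_)
import Data.Nat.Properties as ℕP
open import Data.Product using (_×_; _,_; proj₁; proj₂; uncurry; ∃)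
open import Data.Product.Properties.WithK using (,-injectiveʳ)
open import Data.Sum using (_⊎_; inj₁; inj₂)
open import Data.Unit using (⊤; tt)
open import Data.Vec as Vec using (Vec) renaming (lookup to vlookup)
open import Data.Vec.Properties using (≡-dec; lookup∘tabulate; tabulate∘lookup; tabulate-cong; []=⇒lookup; lookup⇒[]=)
open import Function using (_∘_)
open import Relation.Binary using (DecidableEquality; tri<; tri≈; tri>)
open import Relation.Binary.PropositionalEquality
open import Relation.Nullary using (Dec; yes; no; does; ¬_; contradiction)
import Relation.Nullary.Decidable as Dec
open import Relation.Unary using (Decidable)

does≡true⇒ : ∀ {P : Set} (d : Dec P) → does d ≡ true → P
does≡true⇒ (yes p) _ = p

does-∧-implied : ∀ {P P′ : Set} (d : Dec P) (d′ : Dec P′) → (P → P′) → does d ∧ does d′ ≡ does d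
does-∧-implied (yes p) (yes _) _ = refl
does-∧-implied (yes p) (no ¬p′) f = ⊥-elim (¬p′ (f p))
does-∧-implied (no _) _ _ = refl

does-iff : ∀ {P P′ : Set} (d : Dec P) (d′ : Dec P′) → (P → P′) → (P′ → P) → does d ≡ does d′
does-iff (yes _) (yes _) _ _ = refl
does-iff (no _) (no _) _ _ = refl
does-iff (yes p) (no ¬p′) to _ = ⊥-elim (¬p′ (to p))
does-iff (no ¬p) (yes p′) _ from = ⊥-elim (¬p (from p′))

does-∧⁺ : ∀ {P P′ : Set} (d : Dec P) (d′ : Dec P′) → P → P′ → does d ∧ does d′ ≡ true
does-∧⁺ d d′ p p′ = cong₂ _∧_ (Dec.dec-true d p) (Dec.dec-true d′ p′)

does-∧⁻ : ∀ {P P′ : Set} (d : Dec P) (d′ : Dec P′) → does d ∧ does d′ ≡ true → P × P′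
does-∧⁻ (yes p) (yes p′) _ = p , p′

𝟙 : Bool → ℤ
𝟙 b = if b then 1ℤ else 0ℤ

when : ∀ {P : Set} → Dec P → ℤ → ℤ
when d x = if does d then x else 0ℤ

when-yes : ∀ {P : Set} (d : Dec P) → P → ∀ x → when d x ≡ x
when-yes (yes _) p x = refl
when-yes (no ¬p) p x = ⊥-elim (¬p p)

when-no : ∀ {P : Set} (d : Dec P) → ¬ P → ∀ x → when d x ≡ 0ℤ
when-no (yes p) ¬p x = ⊥-elim (¬p p)
when-no (no _) ¬p x = refl

when-0 : ∀ {P : Set} (d : Dec P) → when d 0ℤ ≡ 0ℤ
when-0 (yes _) = refl
when-0 (no _) = refl

when-+ : ∀ {P : Set} (d : Dec P) x y → when d (x + y) ≡ when d x + when d y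
when-+ (yes _) x y = refl
when-+ (no _) x y = refl

when-neg : ∀ {P : Set} (d : Dec P) x → when d (- x) ≡ - when d x
when-neg (yes _) x = refl
when-neg (no _) x = refl

when-comm : ∀ {P P′ : Set} (d : Dec P) (d′ : Dec P′) x → when d (when d′ x) ≡ when d′ (when d x)
when-comm (yes _) (yes _) x = refl
when-comm (yes _) (no _) x = refl
when-comm (no _) (yes _) x = refl
when-comm (no _) (no _) x = refl

when-iff : ∀ {P P′ : Set} (d : Dec P) (d′ : Dec P′) → (P → P′) → (P′ → P) → ∀ x → when d x ≡ when d′ x
when-iff d d′ to from x = cong (λ b → if b then x else 0ℤ) (does-iff d d′ to from)

when³-zero : ∀ {P₁ P₂ P₃ : Set} (d₁ : Dec P₁) (d₂ : Dec P₂) (d₃ : Dec P₃) {x} →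
             (P₁ → P₂ → P₃ → x ≡ 0ℤ) → when d₁ (when d₂ (when d₃ x)) ≡ 0ℤ
when³-zero (yes p₁) (yes p₂) (yes p₃) x≡0 = x≡0 p₁ p₂ p₃
when³-zero (yes _) (yes _) (no _) _ = refl
when³-zero (yes _) (no _) _ _ = refl
when³-zero (no _) _ _ _ = refl

module _ {A : Set} {P : A → Set} (P? : Decidable P) where

  find-sound : ∀ xs {p} → List.find P? xs ≡ just p → P p
  find-sound (x ∷ xs) found with P? x
  ... | yes Px = subst P (just-injective found) Px
  ... | no _ = find-sound xs found

  find-complete : ∀ {xs p} → p ∈ₗ xs → P p → ¬ List.find P? xs ≡ nothing
  find-complete {x ∷ xs} (here refl) Pp none with P? x
  ... | no ¬Px = ¬Px Pp
  find-complete {x ∷ xs} (there p∈xs) Pp none with P? x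
  ... | no _ = find-complete p∈xs Pp none

  find-cong : ∀ {P′ : A → Set} (P′? : Decidable P′) → (∀ x → P x → P′ x) → (∀ x → P′ x → P x) →
              ∀ xs → List.find P? xs ≡ List.find P′? xs
  find-cong P′? to from [] = refl
  find-cong P′? to from (x ∷ xs) with P? x | P′? x
  ... | yes _ | yes _ = refl
  ... | no _ | no _ = find-cong P′? to from xs
  ... | yes Px | no ¬P′x = ⊥-elim (¬P′x (to x Px))
  ... | no ¬Px | yes P′x = ⊥-elim (¬Px (from x P′x))

Linked-lookup : ∀ {A : Set} {R : A → A → Set} {xs : List A} → Linked R xs →
  ∀ (j j′ : Fin (List.length xs)) → toℕ j′ ≡ ℕ.suc (toℕ j) → R (List.lookup xs j) (List.lookup xs j′)
Linked-lookup (r ∷ _) zero (suc zero) _ = r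
Linked-lookup (_ ∷ l) (suc j) (suc j′) e = Linked-lookup l j j′ (ℕP.suc-injective e)

∑ : ∀ {A : Set} → List A → (A → ℤ) → ℤ
∑ [] f = 0ℤ
∑ (x ∷ xs) f = f x + ∑ xs f

module _ {A : Set} where

  ∑-cong : ∀ (xs : List A) {f g : A → ℤ} → (∀ x → f x ≡ g x) → ∑ xs f ≡ ∑ xs g
  ∑-cong [] e = refl
  ∑-cong (x ∷ xs) e = cong₂ _+_ (e x) (∑-cong xs e)

  ∑-++ : ∀ (xs ys : List A) f → ∑ (xs ++ ys) f ≡ ∑ xs f + ∑ ys f
  ∑-++ [] ys f = sym (+-identityˡ _)
  ∑-++ (x ∷ xs) ys f = trans (cong (_+_ (f x)) (∑-++ xs ys f)) (sym (+-assoc (f x) _ _))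

  ∑-zero : ∀ (xs : List A) → ∑ xs (λ _ → 0ℤ) ≡ 0ℤ
  ∑-zero [] = refl
  ∑-zero (x ∷ xs) = trans (+-identityˡ _) (∑-zero xs)

  ∑-+ : ∀ (xs : List A) f g → ∑ xs (λ x → f x + g x) ≡ ∑ xs f + ∑ xs g
  ∑-+ [] f g = refl
  ∑-+ (x ∷ xs) f g = trans (cong (_+_ (f x + g x)) (∑-+ xs f g)) (interchange (f x) (g x) _ _)
    where
    interchange : ∀ a b c d → (a + b) + (c + d) ≡ (a + c) + (b + d)
    interchange = solve-∀

  ∑-*ˡ : ∀ (xs : List A) c f → ∑ xs (λ x → c ℤ.* f x) ≡ c ℤ.* ∑ xs f
  ∑-*ˡ [] c f = sym (*-zeroʳ c)
  ∑-*ˡ (x ∷ xs) c f = trans (cong (_+_ (c ℤ.* f x)) (∑-*ˡ xs c f)) (sym (*-distribˡ-+ c (f x) _))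

  ∑-neg : ∀ (xs : List A) f → ∑ xs (λ x → - f x) ≡ - ∑ xs f
  ∑-neg [] f = refl
  ∑-neg (x ∷ xs) f = trans (cong (_+_ (- f x)) (∑-neg xs f)) (sym (neg-distrib-+ (f x) _))

  ∑-filter : ∀ {P : A → Set} (P? : Decidable P) (xs : List A) f →
             ∑ (filter P? xs) f ≡ ∑ xs (λ x → when (P? x) (f x))
  ∑-filter P? [] f = refl
  ∑-filter P? (x ∷ xs) f with P? x
  ... | yes _ = cong (_+_ (f x)) (∑-filter P? xs f)
  ... | no _ = trans (∑-filter P? xs f) (sym (+-identityˡ _))

  ∑-when : ∀ {P : Set} (d : Dec P) (xs : List A) f → ∑ xs (λ x → when d (f x)) ≡ when d (∑ xs f)
  ∑-when (yes _) xs f = refl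
  ∑-when (no _) xs f = ∑-zero xs

∑-map : ∀ {A B : Set} (h : A → B) (xs : List A) f → ∑ (map h xs) f ≡ ∑ xs (f ∘ h)
∑-map h [] f = refl
∑-map h (x ∷ xs) f = cong (_+_ (f (h x))) (∑-map h xs f)

module _ {A B : Set} where

  ∑-concatMap : ∀ (h : A → List B) (xs : List A) f → ∑ (concatMap h xs) f ≡ ∑ xs (λ x → ∑ (h x) f)
  ∑-concatMap h [] f = refl
  ∑-concatMap h (x ∷ xs) f = trans (∑-++ (h x) (concatMap h xs) f) (cong (_+_ (∑ (h x) f)) (∑-concatMap h xs f))

  ∑-cartesianProduct : ∀ (xs : List A) (ys : List B) f →
                       ∑ (cartesianProduct xs ys) f ≡ ∑ xs (λ x → ∑ ys (λ y → f (x , y)))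
  ∑-cartesianProduct [] ys f = refl
  ∑-cartesianProduct (x ∷ xs) ys f = trans (∑-++ (map (x ,_) ys) _ f)
    (cong₂ _+_ (∑-map (x ,_) ys f) (∑-cartesianProduct xs ys f))

  ∑-swap : ∀ (xs : List A) (ys : List B) (f : A → B → ℤ) →
           ∑ xs (λ x → ∑ ys (f x)) ≡ ∑ ys (λ y → ∑ xs (λ x → f x y))
  ∑-swap [] ys f = sym (∑-zero ys)
  ∑-swap (x ∷ xs) ys f = trans (cong (_+_ (∑ ys (f x))) (∑-swap xs ys f))
    (sym (∑-+ ys (f x) (λ y → ∑ xs (λ x′ → f x′ y))))

∑-tabulate : ∀ {A : Set} n (h : Fin n → A) f → ∑ (tabulate h) f ≡ ∑ (allFin n) (f ∘ h)
∑-tabulate ℕ.zero h f = refl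
∑-tabulate (ℕ.suc n) h f = cong (_+_ (f (h zero)))
  (trans (∑-tabulate n (h ∘ suc) f) (sym (∑-tabulate n suc (f ∘ h))))

-- Lists enumerating a type: every element occurs exactly once

module _ {A : Set} (_≟_ : DecidableEquality A) where

  record Enumerates (xs : List A) : Set where
    constructor enumerates
    field ∑-when≟ : ∀ (f : A → ℤ) y → ∑ xs (λ x → when (x ≟ y) (f x)) ≡ f y

  module _ {xs : List A} (enum : Enumerates xs) where
    open Enumerates enum

    ∑-whenˡ : ∀ (f : A → ℤ) y → ∑ xs (λ x → when (y ≟ x) (f x)) ≡ f y
    ∑-whenˡ f y = trans (∑-cong xs (λ x → when-iff (y ≟ x) (x ≟ y) sym sym (f x))) (∑-when≟ f y)

    ∑-supported : ∀ (f : A → ℤ) y → (∀ x → ¬ x ≡ y → f x ≡ 0ℤ) → ∑ xs f ≡ f y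
    ∑-supported f y vanish = trans (∑-cong xs restrict) (∑-when≟ f y)
      where
      restrict : ∀ x → f x ≡ when (x ≟ y) (f x)
      restrict x with x ≟ y
      ... | yes _ = refl
      ... | no x≢y = vanish x x≢y

    ∑-reindex : (φ ψ : A → A) → (∀ x → ψ (φ x) ≡ x) → (∀ x → φ (ψ x) ≡ x) →
                ∀ f → ∑ xs (f ∘ φ) ≡ ∑ xs f
    ∑-reindex φ ψ ψφ φψ f = begin
      ∑ xs (f ∘ φ)                                    ≡⟨ ∑-cong xs (λ x → sym (∑-whenˡ f (φ x))) ⟩
      ∑ xs (λ x → ∑ xs (λ y → when (φ x ≟ y) (f y)))  ≡⟨ ∑-swap xs xs _ ⟩
      ∑ xs (λ y → ∑ xs (λ x → when (φ x ≟ y) (f y)))  ≡⟨ ∑-cong xs (λ y → ∑-cong xs (λ x → transport x y)) ⟩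
      ∑ xs (λ y → ∑ xs (λ x → when (x ≟ ψ y) (f y)))  ≡⟨ ∑-cong xs (λ y → ∑-when≟ (λ _ → f y) (ψ y)) ⟩
      ∑ xs f                                          ∎
      where
      open ≡-Reasoning
      transport : ∀ x y → when (φ x ≟ y) (f y) ≡ when (x ≟ ψ y) (f y)
      transport x y = when-iff (φ x ≟ y) (x ≟ ψ y)
        (λ e → trans (sym (ψφ x)) (cong ψ e)) (λ e → trans (cong φ e) (φψ y)) (f y)

allFin-enumerates : ∀ n → Enumerates FinP._≟_ (allFin n)
allFin-enumerates n = enumerates (pick n)
  where
  pick : ∀ n (f : Fin n → ℤ) y → ∑ (allFin n) (λ x → when (x FinP.≟ y) (f x)) ≡ f y
  pick (ℕ.suc n) f zero = trans (cong (_+_ (f zero))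
    (trans (∑-tabulate n suc _) (∑-zero (allFin n)))) (+-identityʳ _)
  pick (ℕ.suc n) f (suc y) = trans (+-identityˡ _)
    (trans (∑-tabulate n suc _) (trans (∑-cong (allFin n) shift) (pick n (f ∘ suc) y)))
    where
    shift : ∀ x → when (suc x FinP.≟ suc y) (f (suc x)) ≡ when (x FinP.≟ y) (f (suc x))
    shift x with x FinP.≟ y
    ... | yes _ = refl
    ... | no _ = refl

module _ {A B : Set} (_≟A_ : DecidableEquality A) (_≟B_ : DecidableEquality B) where

  _≟×_ : DecidableEquality (A × B)
  (a , b) ≟× (c , d) = Dec.map′ (λ (e₁ , e₂) → cong₂ _,_ e₁ e₂) (λ e → cong proj₁ e , cong proj₂ e) (a ≟A c Dec.×-dec b ≟B d)

  private
    when-,≟ : ∀ x a y b z → when ((x , y) ≟× (a , b)) z ≡ when (x ≟A a) (when (y ≟B b) z)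
    when-,≟ x a y b z with x ≟A a | y ≟B b
    ... | yes _ | yes _ = refl
    ... | yes _ | no _ = refl
    ... | no _ | yes _ = refl
    ... | no _ | no _ = refl

  cartesianProduct-enumerates : ∀ {xs ys} → Enumerates _≟A_ xs → Enumerates _≟B_ ys →
                                Enumerates _≟×_ (cartesianProduct xs ys)
  cartesianProduct-enumerates {xs} {ys} (enumerates pickX) (enumerates pickY) = enumerates λ f (a , b) →
    trans (∑-cartesianProduct xs ys _)
    (trans (∑-cong xs (λ x → ∑-cong ys (λ y → when-,≟ x a y b _)))
    (trans (∑-cong xs (λ x → ∑-when (x ≟A a) ys _))
    (trans (∑-cong xs (λ x → cong (when (x ≟A a)) (pickY (λ y → f (x , y)) b)))
    (pickX (λ x → f (x , b)) a))))

module _ {A : Set} (_≟_ : DecidableEquality A) where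

  private
    when-∷≟ : ∀ {m} x a (y w : Vec A m) z →
              when (≡-dec _≟_ (x Vec.∷ y) (a Vec.∷ w)) z ≡ when (x ≟ a) (when (≡-dec _≟_ y w) z)
    when-∷≟ x a y w z with x ≟ a | ≡-dec _≟_ y w
    ... | yes _ | yes _ = refl
    ... | yes _ | no _ = refl
    ... | no _ | yes _ = refl
    ... | no _ | no _ = refl

  vectors-enumerate : ∀ {m} {xs : List A} {ys : List (Vec A m)} →
    Enumerates _≟_ xs → Enumerates (≡-dec _≟_) ys →
    Enumerates (≡-dec _≟_) (concatMap (λ x → map (x Vec.∷_) ys) xs)
  vectors-enumerate {xs = xs} {ys} (enumerates pickX) (enumerates pickY) = enumerates λ where
    f (a Vec.∷ w) →
      trans (∑-concatMap _ xs _)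
      (trans (∑-cong xs (λ x → ∑-map (x Vec.∷_) ys _))
      (trans (∑-cong xs (λ x → ∑-cong ys (λ y → when-∷≟ x a y w _)))
      (trans (∑-cong xs (λ x → ∑-when (x ≟ a) ys _))
      (trans (∑-cong xs (λ x → cong (when (x ≟ a)) (pickY (λ y → f (x Vec.∷ y)) w)))
      (pickX (λ x → f (x Vec.∷ w)) a)))))

allVecs-enumerates : ∀ {n} m → Enumerates (≡-dec (FinP._≟_ {n})) (allVecs {n} m)
allVecs-enumerates ℕ.zero = enumerates λ { f Vec.[] → +-identityʳ _ }
allVecs-enumerates {n} (ℕ.suc m) = vectors-enumerate FinP._≟_ (allFin-enumerates n) (allVecs-enumerates m)

allSubsets-enumerates : ∀ n → Enumerates (≡-dec BoolP._≟_) (allSubsets n)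
allSubsets-enumerates ℕ.zero = enumerates λ { f Vec.[] → +-identityʳ _ }
allSubsets-enumerates (ℕ.suc n) = vectors-enumerate BoolP._≟_ bools (allSubsets-enumerates n)
  where
  bools : Enumerates BoolP._≟_ (true ∷ false ∷ [])
  bools = enumerates λ where
    f true → trans (cong (_+_ (f true)) (+-identityʳ 0ℤ)) (+-identityʳ _)
    f false → trans (+-identityˡ _) (+-identityʳ _)

module _ {n : ℕ} {g : Fin n → Bool} {k : Fin n} where

  ∈-tabulate⁺ : g k ≡ true → k ∈ Vec.tabulate g
  ∈-tabulate⁺ gk = lookup⇒[]= k (Vec.tabulate g) (trans (lookup∘tabulate g k) gk)

  ∈-tabulate⁻ : k ∈ Vec.tabulate g → g k ≡ true
  ∈-tabulate⁻ k∈ = trans (sym (lookup∘tabulate g k)) ([]=⇒lookup k∈)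

does-∈?-tabulate : ∀ {n} (g : Fin n → Bool) k → does (k ∈? Vec.tabulate g) ≡ g k
does-∈?-tabulate g k with k ∈? Vec.tabulate g | g k in gk
... | yes k∈ | true = refl
... | yes k∈ | false = contradiction (trans (sym (∈-tabulate⁻ k∈)) gk) λ ()
... | no k∉ | true = ⊥-elim (k∉ (∈-tabulate⁺ gk))
... | no _ | false = refl

∣∣≡∑ : ∀ {n} (A : Subset n) → + ∣ A ∣ ≡ ∑ (allFin n) (λ k → 𝟙 (does (k ∈? A)))
∣∣≡∑ {ℕ.zero} Vec.[] = refl
∣∣≡∑ {ℕ.suc n} (true Vec.∷ A) = cong (_+_ 1ℤ) (trans (∣∣≡∑ A) (sym (∑-tabulate n suc _)))
∣∣≡∑ {ℕ.suc n} (false Vec.∷ A) = trans (∣∣≡∑ A) (trans (sym (∑-tabulate n suc _)) (sym (+-identityˡ _)))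

infix 4 _≟T_
_≟T_ : ∀ {n} → DecidableEquality (Tab n)
_≟T_ = ≡-dec FinP._≟_

δ : ∀ {n} → Tab n → Tab n → ℤ
δ u v = when (u ≟T v) 1ℤ

lookup-∘t : ∀ {n} (π τ : Tab n) k → vlookup (π ∘t τ) k ≡ vlookup π (vlookup τ k)
lookup-∘t π τ k = lookup∘tabulate _ k

tab-ext : ∀ {n} {π τ : Tab n} → (∀ k → vlookup π k ≡ vlookup τ k) → π ≡ τ
tab-ext {π = π} {τ} e = trans (sym (tabulate∘lookup π)) (trans (tabulate-cong e) (tabulate∘lookup τ))

record AreInverse {n} (g g′ : Tab n) : Set where
  constructor _,_
  field
    left-inverse  : ∀ k → vlookup g′ (vlookup g k) ≡ k
    right-inverse : ∀ k → vlookup g (vlookup g′ k) ≡ k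

module _ {n : ℕ} where

  AreInverse⇒IsPerm : ∀ {g g′ : Tab n} → AreInverse g g′ → IsPerm g
  AreInverse⇒IsPerm {g′ = g′} (g′g , _) i j e = trans (sym (g′g i)) (trans (cong (vlookup g′) e) (g′g j))

  AreInverse-∘ : ∀ {π π′ ρ ρ′ : Tab n} → AreInverse π π′ → AreInverse ρ ρ′ → AreInverse (π ∘t ρ) (ρ′ ∘t π′)
  AreInverse-∘ {π} {π′} {ρ} {ρ′} (π′π , ππ′) (ρ′ρ , ρρ′) =
    (λ k → trans (lookup-∘t ρ′ π′ _) (trans (cong (λ z → vlookup ρ′ (vlookup π′ z)) (lookup-∘t π ρ k))
           (trans (cong (vlookup ρ′) (π′π _)) (ρ′ρ k)))) ,
    (λ k → trans (lookup-∘t π ρ _) (trans (cong (λ z → vlookup π (vlookup ρ z)) (lookup-∘t ρ′ π′ k))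
           (trans (cong (vlookup π) (ρρ′ _)) (ππ′ k))))

  IsPerm-∘ : ∀ {π τ : Tab n} → IsPerm π → IsPerm τ → IsPerm (π ∘t τ)
  IsPerm-∘ {π} {τ} p q i j e = q i j (p _ _ (trans (sym (lookup-∘t π τ i)) (trans e (lookup-∘t π τ j))))

  IsPerm-∘⁻ʳ : ∀ {π τ : Tab n} → IsPerm (π ∘t τ) → IsPerm τ
  IsPerm-∘⁻ʳ {π} {τ} p i j e = p i j (trans (lookup-∘t π τ i) (trans (cong (vlookup π) e) (sym (lookup-∘t π τ j))))

  IsPerm-∘⁻ˡ : ∀ {π τ τ′ : Tab n} → AreInverse τ τ′ → IsPerm (π ∘t τ) → IsPerm π
  IsPerm-∘⁻ˡ {π} {τ} (_ , ττ′) p i j e = trans (sym (ττ′ i)) (trans (cong (vlookup τ) (p _ _ lhs)) (ττ′ j))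
    where
    lhs : vlookup (π ∘t τ) _ ≡ vlookup (π ∘t τ) _
    lhs = trans (lookup-∘t π τ _) (trans (cong (vlookup π) (ττ′ i))
          (trans e (trans (cong (vlookup π) (sym (ττ′ j))) (sym (lookup-∘t π τ _)))))

  ∘t-moveˡ : ∀ {g g′ : Tab n} → AreInverse g g′ → ∀ z u → (g ∘t z ≡ u → z ≡ g′ ∘t u) × (z ≡ g′ ∘t u → g ∘t z ≡ u)
  ∘t-moveˡ {g} {g′} (g′g , gg′) z u =
    (λ e → tab-ext λ k → trans (sym (g′g _)) (trans (cong (vlookup g′) (sym (lookup-∘t g z k)))
                         (trans (cong (λ t → vlookup g′ (vlookup t k)) e) (sym (lookup-∘t g′ u k))))) ,
    (λ e → tab-ext λ k → trans (lookup-∘t g z k) (trans (cong (λ t → vlookup g (vlookup t k)) e)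
                         (trans (cong (vlookup g) (lookup-∘t g′ u k)) (gg′ _))))

  ∘t-moveʳ : ∀ {g g′ : Tab n} → AreInverse g g′ → ∀ w u → (w ∘t g ≡ u → w ≡ u ∘t g′) × (w ≡ u ∘t g′ → w ∘t g ≡ u)
  ∘t-moveʳ {g} {g′} (g′g , gg′) w u =
    (λ e → tab-ext λ k → trans (cong (vlookup w) (sym (gg′ k))) (trans (sym (lookup-∘t w g _))
                         (trans (cong (λ t → vlookup t (vlookup g′ k)) e) (sym (lookup-∘t u g′ k))))) ,
    (λ e → tab-ext λ k → trans (lookup-∘t w g k) (trans (cong (λ t → vlookup t (vlookup g k)) e)
                         (trans (lookup-∘t u g′ _) (cong (vlookup u) (g′g k)))))

IsPerm⇒surjective : ∀ {n} (u : Tab n) → IsPerm u → ∀ y → ∃ λ k → vlookup u k ≡ y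
IsPerm⇒surjective {n} u u-perm y with FinP.any? (λ k → vlookup u k FinP.≟ y)
... | yes hit = hit
... | no miss = pigeonhole-contradiction n refl y
  where
  pigeonhole-contradiction : ∀ m → m ≡ n → Fin m → ∃ λ k → vlookup u k ≡ y
  pigeonhole-contradiction (ℕ.suc m) refl _ = ⊥-elim (no-collision (FinP.pigeonhole (ℕP.n<1+n m) squeeze))
    where
    squeeze : Fin (ℕ.suc m) → Fin m
    squeeze k = Fin.punchOut {i = y} {j = vlookup u k} (λ e → miss (k , sym e))
    no-collision : ¬ (∃ λ i → ∃ λ j → i Fin.< j × squeeze i ≡ squeeze j)
    no-collision (i , j , i<j , eq) = ℕP.<-irrefl (cong toℕ (u-perm i j
      (FinP.punchOut-injective {i = y} (λ e → miss (i , sym e)) (λ e → miss (j , sym e)) eq))) i<j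

module _ {n : ℕ} where

  coeff-∑ : ∀ (x : GA n) v → coeff x v ≡ ∑ x (λ (c , τ) → when (τ ≟T v) c)
  coeff-∑ [] v = refl
  coeff-∑ ((c , τ) ∷ xs) v with ≡-dec FinP._≟_ τ v
  ... | yes _ = cong (_+_ c) (coeff-∑ xs v)
  ... | no _ = trans (coeff-∑ xs v) (sym (+-identityˡ _))

  coeff-concatMap : ∀ {A : Set} (f : A → GA n) (L : List A) v →
                    coeff (concatMap f L) v ≡ ∑ L (λ U → coeff (f U) v)
  coeff-concatMap f L v = trans (coeff-∑ (concatMap f L) v)
    (trans (∑-concatMap f L _) (∑-cong L (λ U → sym (coeff-∑ (f U) v))))

  coeff-*-∑ : ∀ (x y : GA n) v →
              coeff (x * y) v ≡ ∑ x (λ (c , π) → ∑ y (λ (d , τ) → when (π ∘t τ ≟T v) (c ℤ.* d)))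
  coeff-*-∑ x y v = trans (coeff-∑ (x * y) v) (trans (∑-concatMap _ x _) (∑-cong x (λ p → ∑-map _ y _)))

  ∑-terms≡∑-coeff : ∀ (y : GA n) (h : Tab n → ℤ) →
                    ∑ y (λ (d , τ) → d ℤ.* h τ) ≡ ∑ (allVecs n) (λ w → coeff y w ℤ.* h w)
  ∑-terms≡∑-coeff [] h = sym (trans (∑-cong (allVecs n) (λ w → *-zeroˡ (h w))) (∑-zero (allVecs n)))
  ∑-terms≡∑-coeff ((d , τ) ∷ y) h =
    trans (cong₂ _+_ (sym (∑-whenˡ _≟T_ (allVecs-enumerates n) (λ w → d ℤ.* h w) τ)) (∑-terms≡∑-coeff y h))
    (trans (sym (∑-+ (allVecs n) _ _)) (∑-cong (allVecs n) split))
    where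
    split : ∀ w → when (τ ≟T w) (d ℤ.* h w) + coeff y w ℤ.* h w ≡ coeff ((d , τ) ∷ y) w ℤ.* h w
    split w with ≡-dec FinP._≟_ τ w
    ... | yes _ = sym (*-distribʳ-+ (h w) d (coeff y w))
    ... | no _ = +-identityˡ _

  coeff-*-convolution : ∀ (x y : GA n) v →
    coeff (x * y) v ≡ ∑ (allVecs n) (λ w → coeff x w ℤ.* ∑ (allVecs n) (λ u → coeff y u ℤ.* δ (w ∘t u) v))
  coeff-*-convolution x y v = begin
    coeff (x * y) v
      ≡⟨ coeff-*-∑ x y v ⟩
    ∑ x (λ (c , π) → ∑ y (λ (d , τ) → when (π ∘t τ ≟T v) (c ℤ.* d)))
      ≡⟨ ∑-cong x (λ (c , π) → trans (∑-cong y (λ (d , τ) → factor c d (π ∘t τ))) (∑-*ˡ y c _)) ⟩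
    ∑ x (λ (c , π) → c ℤ.* ∑ y (λ (d , τ) → d ℤ.* δ (π ∘t τ) v))
      ≡⟨ ∑-cong x (λ (c , π) → cong (c ℤ.*_) (∑-terms≡∑-coeff y (λ u → δ (π ∘t u) v))) ⟩
    ∑ x (λ (c , π) → c ℤ.* ∑ (allVecs n) (λ u → coeff y u ℤ.* δ (π ∘t u) v))
      ≡⟨ ∑-terms≡∑-coeff x _ ⟩
    ∑ (allVecs n) (λ w → coeff x w ℤ.* ∑ (allVecs n) (λ u → coeff y u ℤ.* δ (w ∘t u) v)) ∎
    where
    open ≡-Reasoning
    factor : ∀ c d t → when (t ≟T v) (c ℤ.* d) ≡ c ℤ.* (d ℤ.* δ t v)
    factor c d t with t ≟T v
    ... | yes _ = cong (c ℤ.*_) (sym (*-identityʳ d))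
    ... | no _ = sym (trans (cong (c ℤ.*_) (*-zeroʳ d)) (*-zeroʳ c))

  *-concatMap : ∀ {A : Set} (x : GA n) (f : A → GA n) (L : List A) →
                x * concatMap f L ≈ concatMap (λ U → x * f U) L
  *-concatMap x f L v = begin
    coeff (x * concatMap f L) v
      ≡⟨ coeff-*-∑ x _ v ⟩
    ∑ x (λ p → ∑ (concatMap f L) (term p))
      ≡⟨ ∑-cong x (λ p → ∑-concatMap f L (term p)) ⟩
    ∑ x (λ p → ∑ L (λ U → ∑ (f U) (term p)))
      ≡⟨ ∑-swap x L _ ⟩
    ∑ L (λ U → ∑ x (λ p → ∑ (f U) (term p)))
      ≡⟨ ∑-cong L (λ U → sym (coeff-*-∑ x (f U) v)) ⟩
    ∑ L (λ U → coeff (x * f U) v)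
      ≡⟨ coeff-concatMap _ L v ⟨
    coeff (concatMap (λ U → x * f U) L) v ∎
    where
    open ≡-Reasoning
    term : ℤ × Tab n → ℤ × Tab n → ℤ
    term (c , π) (d , τ) = when (π ∘t τ ≟T v) (c ℤ.* d)

  coeff-⟦⟧* : ∀ {g g′ : Tab n} → AreInverse g g′ → ∀ y u → coeff (⟦ g ⟧ * y) u ≡ coeff y (g′ ∘t u)
  coeff-⟦⟧* {g} {g′} inv y u = begin
    coeff (⟦ g ⟧ * y) u
      ≡⟨ coeff-*-∑ ⟦ g ⟧ y u ⟩
    ∑ y (λ (d , τ) → when (g ∘t τ ≟T u) (1ℤ ℤ.* d)) + 0ℤ
      ≡⟨ +-identityʳ _ ⟩
    ∑ y (λ (d , τ) → when (g ∘t τ ≟T u) (1ℤ ℤ.* d))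
      ≡⟨ ∑-cong y (λ (d , τ) → cong (when (g ∘t τ ≟T u)) (*-identityˡ d)) ⟩
    ∑ y (λ (d , τ) → when (g ∘t τ ≟T u) d)
      ≡⟨ ∑-cong y (λ (d , τ) → uncurry (when-iff (g ∘t τ ≟T u) (τ ≟T g′ ∘t u)) (∘t-moveˡ inv τ u) d) ⟩
    ∑ y (λ (d , τ) → when (τ ≟T g′ ∘t u) d)
      ≡⟨ coeff-∑ y _ ⟨
    coeff y (g′ ∘t u) ∎
    where open ≡-Reasoning

  coeff-*⟦⟧ : ∀ {g g′ : Tab n} → AreInverse g g′ → ∀ x u → coeff (x * ⟦ g ⟧) u ≡ coeff x (u ∘t g′)
  coeff-*⟦⟧ {g} {g′} inv x u = begin
    coeff (x * ⟦ g ⟧) u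
      ≡⟨ coeff-*-∑ x ⟦ g ⟧ u ⟩
    ∑ x (λ (c , π) → when (π ∘t g ≟T u) (c ℤ.* 1ℤ) + 0ℤ)
      ≡⟨ ∑-cong x (λ (c , π) → trans (+-identityʳ _) (cong (when (π ∘t g ≟T u)) (*-identityʳ c))) ⟩
    ∑ x (λ (c , π) → when (π ∘t g ≟T u) c)
      ≡⟨ ∑-cong x (λ (c , π) → uncurry (when-iff (π ∘t g ≟T u) (π ≟T u ∘t g′)) (∘t-moveʳ inv π u) c) ⟩
    ∑ x (λ (c , π) → when (π ≟T u ∘t g′) c)
      ≡⟨ coeff-∑ x _ ⟨
    coeff x (u ∘t g′) ∎
    where open ≡-Reasoning

module _ {n : ℕ} {λ′ : Partition n} where

  InR? : (T : Numbering λ′) (ρ : Tab n) → Dec (InR T ρ)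
  InR? T ρ = all? (λ k → rowOf T (vlookup ρ k) FinP.≟ rowOf T k)

  InC? : (T : Numbering λ′) (ζ : Tab n) → Dec (InC T ζ)
  InC? T ζ = all? (λ k → colOf T (vlookup ζ k) ℕ.≟ colOf T k)

coeff-weighted-Sym : ∀ {n} {P : Tab n → Set} (P? : Decidable P) (f : Tab n → ℤ) w →
  coeff (map (λ ρ → (f ρ , ρ)) (filter P? (Sym n))) w ≡ when (isPerm? w) (when (P? w) (f w))
coeff-weighted-Sym {n} P? f w =
  trans (coeff-∑ (map (λ ρ → (f ρ , ρ)) (filter P? (Sym n))) w)
  (trans (∑-map _ (filter P? (Sym n)) _)
  (trans (∑-filter P? (Sym n) _)
  (trans (∑-filter isPerm? (allVecs n) _)
  (trans (∑-cong (allVecs n) (λ ρ → trans (cong (when (isPerm? ρ)) (when-comm (P? ρ) (ρ ≟T w) (f ρ)))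
                                          (when-comm (isPerm? ρ) (ρ ≟T w) _)))
  (Enumerates.∑-when≟ (allVecs-enumerates n) (λ ρ → when (isPerm? ρ) (when (P? ρ) (f ρ))) w)))))

module _ {n : ℕ} {λ′ : Partition n} where

  coeff-a : ∀ (T : Numbering λ′) w → coeff (a T) w ≡ when (isPerm? w) (when (InR? T w) 1ℤ)
  coeff-a T = coeff-weighted-Sym (InR? T) (λ _ → 1ℤ)

  coeff-b : ∀ (T : Numbering λ′) w → coeff (b T) w ≡ when (isPerm? w) (when (InC? T w) (sgn w))
  coeff-b T = coeff-weighted-Sym (InC? T) sgn

  σ-lookup : ∀ (U T : Numbering λ′) k → vlookup (σ U T) k ≡ entry T (pos U k)
  σ-lookup U T k = lookup∘tabulate _ k

  pos-σ : ∀ (U T : Numbering λ′) k → pos T (vlookup (σ U T) k) ≡ pos U k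
  pos-σ U T k = trans (cong (pos T) (σ-lookup U T k)) (pos-entry T _)

  σ-inverse : ∀ (U T : Numbering λ′) → AreInverse (σ U T) (σ T U)
  σ-inverse U T = (λ k → trans (σ-lookup T U _) (trans (cong (entry U) (pos-σ U T k)) (entry-pos U k)))
                , (λ k → trans (σ-lookup U T _) (trans (cong (entry T) (pos-σ T U k)) (entry-pos T k)))

  σ-isPerm : ∀ (U T : Numbering λ′) → IsPerm (σ U T)
  σ-isPerm U T = AreInverse⇒IsPerm (σ-inverse U T)

  RowsMatch : Numbering λ′ → Numbering λ′ → Tab n → Set
  RowsMatch T U u = ∀ k → rowOf T (vlookup u k) ≡ rowOf U k

  rowsMatch? : ∀ T U u → Dec (RowsMatch T U u)
  rowsMatch? T U u = all? (λ k → rowOf T (vlookup u k) FinP.≟ rowOf U k)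

  coeff-σa : ∀ (U T : Numbering λ′) u →
             coeff (⟦ σ U T ⟧ * a U) u ≡ when (isPerm? u) (when (rowsMatch? T U u) 1ℤ)
  coeff-σa U T u =
    trans (coeff-⟦⟧* (σ-inverse U T) (a U) u)
    (trans (coeff-a U (σ T U ∘t u))
    (trans (cong (when (isPerm? (σ T U ∘t u))) (when-iff (InR? U (σ T U ∘t u)) (rowsMatch? T U u) to from 1ℤ))
    (when-iff (isPerm? (σ T U ∘t u)) (isPerm? u) (IsPerm-∘⁻ʳ {π = σ T U} {u}) (IsPerm-∘ {π = σ T U} {u} (σ-isPerm T U)) _)))
    where
    row-σ : ∀ k → rowOf U (vlookup (σ T U ∘t u) k) ≡ rowOf T (vlookup u k)
    row-σ k = cong proj₁ (trans (cong (pos U) (lookup-∘t (σ T U) u k)) (pos-σ T U (vlookup u k)))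
    to : InR U (σ T U ∘t u) → RowsMatch T U u
    to h k = trans (sym (row-σ k)) (h k)
    from : RowsMatch T U u → InR U (σ T U ∘t u)
    from h k = trans (row-σ k) (h k)

  coeff-aσ : ∀ (U T : Numbering λ′) u →
             coeff (a T * ⟦ σ U T ⟧) u ≡ when (isPerm? u) (when (rowsMatch? T U u) 1ℤ)
  coeff-aσ U T u =
    trans (coeff-*⟦⟧ (σ-inverse U T) (a T) u)
    (trans (coeff-a T (u ∘t σ T U))
    (trans (cong (when (isPerm? (u ∘t σ T U))) (when-iff (InR? T (u ∘t σ T U)) (rowsMatch? T U u) to from 1ℤ))
    (when-iff (isPerm? (u ∘t σ T U)) (isPerm? u) (IsPerm-∘⁻ˡ {π = u} (σ-inverse T U)) (λ p → IsPerm-∘ {π = u} {σ T U} p (σ-isPerm T U)) _)))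
    where
    to : InR T (u ∘t σ T U) → RowsMatch T U u
    to h j = trans (cong (λ z → rowOf T (vlookup u z)) (sym (AreInverse.left-inverse (σ-inverse U T) j)))
             (trans (cong (rowOf T) (sym (lookup-∘t u (σ T U) (vlookup (σ U T) j))))
             (trans (h (vlookup (σ U T) j)) (cong proj₁ (pos-σ U T j))))
    from : RowsMatch T U u → InR T (u ∘t σ T U)
    from h k = trans (cong (rowOf T) (lookup-∘t u (σ T U) k)) (trans (h _) (cong proj₁ (pos-σ T U k)))

σ-intertwines-a : ∀ {n} {λ′ : Partition n} (U T : Numbering λ′) → ⟦ σ U T ⟧ * a U ≈ a T * ⟦ σ U T ⟧
σ-intertwines-a U T u = trans (coeff-σa U T u) (sym (coeff-aσ U T u))

module _ {n : ℕ} {λ′ : Partition n} (T S : Numbering λ′) (i : ℕ) (Q : Subset n) where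

  γ-cofactor : GA n
  γ-cofactor = concatMap (λ U → ⟦ σ U T ⟧) (Ξ S i Q)

  γ≈a*cofactor : γ T S i Q ≈ a T * γ-cofactor
  γ≈a*cofactor v =
    trans (coeff-concatMap _ (Ξ S i Q) v)
    (trans (∑-cong (Ξ S i Q) (λ U → σ-intertwines-a U T v))
    (trans (sym (coeff-concatMap _ (Ξ S i Q) v))
    (sym (*-concatMap (a T) _ (Ξ S i Q) v))))

-- Signs of permutations

_<ᵇ_ : ∀ {n} → Fin n → Fin n → Bool
p <ᵇ q = does (p Fin.<? q)

<ᵇ-true : ∀ {n} {p q : Fin n} → p Fin.< q → p <ᵇ q ≡ true
<ᵇ-true {p = p} {q} = Dec.dec-true (p Fin.<? q)

<ᵇ-false : ∀ {n} {p q : Fin n} → ¬ p Fin.< q → p <ᵇ q ≡ false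
<ᵇ-false {p = p} {q} = Dec.dec-false (p Fin.<? q)

<ᵇ-irrefl : ∀ {n} (p : Fin n) → p <ᵇ p ≡ false
<ᵇ-irrefl p = <ᵇ-false {p = p} {p} (ℕP.<-irrefl refl)

<ᵇ-flip : ∀ {n} {p q : Fin n} → ¬ p ≡ q → q <ᵇ p ≡ not (p <ᵇ q)
<ᵇ-flip {p = p} {q} p≢q with FinP.<-cmp p q
... | tri< p<q _ _ = trans (<ᵇ-false (ℕP.<-asym p<q)) (cong not (sym (<ᵇ-true p<q)))
... | tri≈ _ p≡q _ = ⊥-elim (p≢q p≡q)
... | tri> _ _ q<p = trans (<ᵇ-true q<p) (cong not (sym (<ᵇ-false (ℕP.<-asym q<p))))

𝟙-both-false : ∀ {n} (x y z w : Fin n) → (x Fin.< y → z Fin.< w → ⊥) → 𝟙 (x <ᵇ y ∧ z <ᵇ w) ≡ 0ℤ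
𝟙-both-false x y z w incompatible with x Fin.<? y
... | yes x<y = cong₂ (λ c d → 𝟙 (c ∧ d)) (<ᵇ-true x<y) (<ᵇ-false (incompatible x<y))
... | no x≮y = cong (λ c → 𝟙 (c ∧ z <ᵇ w)) (<ᵇ-false x≮y)

∑² : ∀ n → (Fin n → Fin n → ℤ) → ℤ
∑² n f = ∑ (allFin n) (λ p → ∑ (allFin n) (f p))

module _ (n : ℕ) where

  ∑²-cong : ∀ {f g : Fin n → Fin n → ℤ} → (∀ p q → f p q ≡ g p q) → ∑² n f ≡ ∑² n g
  ∑²-cong e = ∑-cong (allFin n) (λ p → ∑-cong (allFin n) (e p))

  ∑²-+ : ∀ (f g : Fin n → Fin n → ℤ) → ∑² n (λ p q → f p q + g p q) ≡ ∑² n f + ∑² n g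
  ∑²-+ f g = trans (∑-cong (allFin n) (λ p → ∑-+ (allFin n) (f p) (g p))) (∑-+ (allFin n) _ _)

  ∑²-*ˡ : ∀ c (f : Fin n → Fin n → ℤ) → ∑² n (λ p q → c ℤ.* f p q) ≡ c ℤ.* ∑² n f
  ∑²-*ˡ c f = trans (∑-cong (allFin n) (λ p → ∑-*ˡ (allFin n) c (f p))) (∑-*ˡ (allFin n) c _)

  ∑²-swap : ∀ (f : Fin n → Fin n → ℤ) → ∑² n f ≡ ∑² n (λ p q → f q p)
  ∑²-swap f = ∑-swap (allFin n) (allFin n) f

  ∑²-reindex : ∀ (φ ψ : Fin n → Fin n) → (∀ x → ψ (φ x) ≡ x) → (∀ x → φ (ψ x) ≡ x) →
               ∀ f → ∑² n (λ p q → f (φ p) (φ q)) ≡ ∑² n f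
  ∑²-reindex φ ψ ψφ φψ f =
    trans (∑-cong (allFin n) (λ p → ∑-reindex FinP._≟_ (allFin-enumerates n) φ ψ ψφ φψ (f (φ p))))
          (∑-reindex FinP._≟_ (allFin-enumerates n) φ ψ ψφ φψ (λ p → ∑ (allFin n) (f p)))

  private
    split-by-order : ∀ (p q : Fin n) x → x ≡ when (p Fin.<? q) x + when (q Fin.<? p) x + when (p FinP.≟ q) x
    split-by-order p q x with FinP.<-cmp p q
    ... | tri< p<q p≢q q≮p = sym (trans (cong₂ (λ u v → u + v + when (p FinP.≟ q) x)
                               (when-yes (p Fin.<? q) p<q x) (when-no (q Fin.<? p) q≮p x))
                             (trans (cong (_+_ (x + 0ℤ)) (when-no (p FinP.≟ q) p≢q x))
                             (trans (+-identityʳ _) (+-identityʳ _))))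
    ... | tri≈ p≮q p≡q q≮p = sym (trans (cong₂ (λ u v → u + v + when (p FinP.≟ q) x)
                               (when-no (p Fin.<? q) p≮q x) (when-no (q Fin.<? p) q≮p x))
                             (trans (cong (_+_ 0ℤ) (when-yes (p FinP.≟ q) p≡q x)) (+-identityˡ x)))
    ... | tri> p≮q p≢q q<p = sym (trans (cong₂ (λ u v → u + v + when (p FinP.≟ q) x)
                               (when-no (p Fin.<? q) p≮q x) (when-yes (q Fin.<? p) q<p x))
                             (trans (cong (_+_ (0ℤ + x)) (when-no (p FinP.≟ q) p≢q x))
                             (trans (+-identityʳ _) (+-identityˡ _))))

  ∑²-by-pairs : ∀ (f : Fin n → Fin n → ℤ) →
    ∑² n f ≡ ∑² n (λ p q → when (p Fin.<? q) (f p q + f q p) + when (p FinP.≟ q) (f p q))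
  ∑²-by-pairs f = begin
    ∑² n f
      ≡⟨ ∑²-cong (λ p q → split-by-order p q (f p q)) ⟩
    ∑² n (λ p q → lt p q (f p q) + gt p q (f p q) + eq p q (f p q))
      ≡⟨ trans (∑²-+ _ _) (cong (_+ ∑² n (λ p q → eq p q (f p q))) (∑²-+ _ _)) ⟩
    ∑² n (λ p q → lt p q (f p q)) + ∑² n (λ p q → gt p q (f p q)) + ∑² n (λ p q → eq p q (f p q))
      ≡⟨ cong (λ z → ∑² n (λ p q → lt p q (f p q)) + z + ∑² n (λ p q → eq p q (f p q))) (∑²-swap _) ⟩
    ∑² n (λ p q → lt p q (f p q)) + ∑² n (λ p q → lt p q (f q p)) + ∑² n (λ p q → eq p q (f p q))
      ≡⟨ trans (cong (_+ ∑² n (λ p q → eq p q (f p q))) (sym (∑²-+ _ _))) (sym (∑²-+ _ _)) ⟩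
    ∑² n (λ p q → lt p q (f p q) + lt p q (f q p) + eq p q (f p q))
      ≡⟨ ∑²-cong (λ p q → cong (_+ eq p q (f p q)) (sym (when-+ (p Fin.<? q) _ _))) ⟩
    ∑² n (λ p q → lt p q (f p q + f q p) + eq p q (f p q)) ∎
    where
    open ≡-Reasoning
    lt gt eq : Fin n → Fin n → ℤ → ℤ
    lt p q = when (p Fin.<? q)
    gt p q = when (q Fin.<? p)
    eq p q = when (p FinP.≟ q)

inversionsℤ : ∀ {n} → Tab n → ℤ
inversionsℤ {n} v = ∑² n (λ p q → 𝟙 (p <ᵇ q ∧ vlookup v q <ᵇ vlookup v p))

inversions≡inversionsℤ : ∀ {n} (v : Tab n) → + inversions v ≡ inversionsℤ v
inversions≡inversionsℤ {n} v =
  trans (length-filter _ (cartesianProduct (allFin n) (allFin n))) (∑-cartesianProduct (allFin n) (allFin n) _)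
  where
  length-filter : ∀ {A : Set} {P : A → Set} (P? : Decidable P) (xs : List A) →
                  + List.length (filter P? xs) ≡ ∑ xs (λ x → 𝟙 (does (P? x)))
  length-filter P? [] = refl
  length-filter P? (x ∷ xs) with does (P? x)
  ... | true = cong (_+_ 1ℤ) (length-filter P? xs)
  ... | false = trans (length-filter P? xs) (sym (+-identityˡ _))

−1^ : ℕ → ℤ
−1^ m = -1ℤ ℤ.^ m

−1^-even : ∀ k → −1^ (2 ℕ.* k) ≡ 1ℤ
−1^-even k = trans (sym (^-*-assoc -1ℤ 2 k)) (^-zeroˡ k)

−1^-square : ∀ m → −1^ m ℤ.* −1^ m ≡ 1ℤ
−1^-square m = trans (sym (^-distribˡ-+-* -1ℤ m m)) (trans (cong (λ j → −1^ (m ℕ.+ j)) (sym (ℕP.+-identityʳ m))) (−1^-even m))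

−1^-parity : ∀ a b c (K : ℤ) → + a + + b + + c ≡ + 2 ℤ.* K → −1^ a ≡ −1^ b ℤ.* −1^ c
−1^-parity a b c (+ k) even = begin
  −1^ a                                                            ≡⟨ *-identityʳ _ ⟨
  −1^ a ℤ.* 1ℤ                                                     ≡⟨ cong (−1^ a ℤ.*_) (cong₂ ℤ._*_ (−1^-square b) (−1^-square c)) ⟨
  −1^ a ℤ.* ((−1^ b ℤ.* −1^ b) ℤ.* (−1^ c ℤ.* −1^ c))     ≡⟨ regroup (−1^ a) (−1^ b) (−1^ c) ⟩
  (−1^ a ℤ.* −1^ b ℤ.* −1^ c) ℤ.* (−1^ b ℤ.* −1^ c)       ≡⟨ cong (ℤ._* (−1^ b ℤ.* −1^ c)) all-three ⟩
  1ℤ ℤ.* (−1^ b ℤ.* −1^ c)                                       ≡⟨ *-identityˡ _ ⟩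
  −1^ b ℤ.* −1^ c                                                ∎
  where
  open ≡-Reasoning
  regroup : ∀ x y z → x ℤ.* ((y ℤ.* y) ℤ.* (z ℤ.* z)) ≡ (x ℤ.* y ℤ.* z) ℤ.* (y ℤ.* z)
  regroup = solve-∀
  all-three : −1^ a ℤ.* −1^ b ℤ.* −1^ c ≡ 1ℤ
  all-three = begin
    −1^ a ℤ.* −1^ b ℤ.* −1^ c   ≡⟨ cong (ℤ._* −1^ c) (^-distribˡ-+-* -1ℤ a b) ⟨
    −1^ (a ℕ.+ b) ℤ.* −1^ c       ≡⟨ ^-distribˡ-+-* -1ℤ (a ℕ.+ b) c ⟨
    −1^ (a ℕ.+ b ℕ.+ c)             ≡⟨ cong −1^ (+-injective (trans even (sym (pos-* 2 k)))) ⟩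
    −1^ (2 ℕ.* k)                   ≡⟨ −1^-even k ⟩
    1ℤ                                ∎
−1^-parity a b c -[1+ k ] ()

module _ {n : ℕ} (w τ τ′ : Tab n) (w-perm : IsPerm w) (inv : AreInverse τ τ′) where
  open AreInverse inv

  private
    A W : Fin n → Fin n → Bool
    A p q = vlookup τ′ p <ᵇ vlookup τ′ q
    W p q = vlookup w q <ᵇ vlookup w p

    H : Fin n → Fin n → ℤ
    H p q = 𝟙 (A p q ∧ W p q) + 𝟙 (p <ᵇ q ∧ W p q) + 𝟙 (A p q ∧ q <ᵇ p)

    h : Fin n → Fin n → ℤ
    h p q = when (p Fin.<? q) (𝟙 (not (A p q) ∨ W p q))

    inversions-w∘τ : inversionsℤ (w ∘t τ) ≡ ∑² n (λ p q → 𝟙 (A p q ∧ W p q))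
    inversions-w∘τ =
      trans (∑²-cong n (λ p q → cong₂ (λ x y → 𝟙 (p <ᵇ q ∧ x <ᵇ y)) (lookup-∘t w τ q) (lookup-∘t w τ p)))
      (trans (sym (∑²-reindex n (vlookup τ′) (vlookup τ) right-inverse left-inverse _))
      (∑²-cong n (λ p q → cong₂ (λ x y → 𝟙 (A p q ∧ vlookup w x <ᵇ vlookup w y)) (right-inverse q) (right-inverse p))))

    inversions-τ : inversionsℤ τ ≡ ∑² n (λ p q → 𝟙 (A p q ∧ q <ᵇ p))
    inversions-τ =
      trans (sym (∑²-reindex n (vlookup τ′) (vlookup τ) right-inverse left-inverse _))
      (∑²-cong n (λ p q → cong₂ (λ x y → 𝟙 (A p q ∧ x <ᵇ y)) (right-inverse q) (right-inverse p)))

    -- For p < q, the indicators that (p, q) and (q, p) contribute to inv(w τ) + inv(w) + inv(τ) sum to an even number.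
    pair-even : ∀ a a′ b b′ → a′ ≡ not a → b′ ≡ not b →
                𝟙 (a ∧ b) + 𝟙 (true ∧ b) + 𝟙 (a ∧ false) + (𝟙 (a′ ∧ b′) + 𝟙 (false ∧ b′) + 𝟙 (a′ ∧ true))
                  ≡ + 2 ℤ.* 𝟙 (not a ∨ b)
    pair-even true  a′ true  b′ refl refl = refl
    pair-even true  a′ false b′ refl refl = refl
    pair-even false a′ true  b′ refl refl = refl
    pair-even false a′ false b′ refl refl = refl

    pair-sum : ∀ p q → when (p Fin.<? q) (H p q + H q p) + when (p FinP.≟ q) (H p q) ≡ + 2 ℤ.* h p q
    pair-sum p q with FinP.<-cmp p q
    ... | tri< p<q p≢q _ =
      trans (cong₂ _+_ (when-yes (p Fin.<? q) p<q _) (when-no (p FinP.≟ q) p≢q _))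
      (trans (+-identityʳ _)
      (trans (cong₂ (λ x y → H′ x y) (<ᵇ-true p<q) (<ᵇ-false (ℕP.<-asym p<q)))
      (trans (pair-even (A p q) (A q p) (W p q) (W q p)
               (<ᵇ-flip (λ e → p≢q (trans (sym (right-inverse p)) (trans (cong (vlookup τ) e) (right-inverse q)))))
               (<ᵇ-flip (λ e → p≢q (sym (w-perm q p e)))))
      (cong (+ 2 ℤ.*_) (sym (when-yes (p Fin.<? q) p<q _))))))
      where
      H′ : Bool → Bool → ℤ
      H′ x y = 𝟙 (A p q ∧ W p q) + 𝟙 (x ∧ W p q) + 𝟙 (A p q ∧ y) + (𝟙 (A q p ∧ W q p) + 𝟙 (y ∧ W q p) + 𝟙 (A q p ∧ x))
    ... | tri≈ p≮p refl _ =
      trans (cong₂ _+_ (when-no (p Fin.<? p) p≮p _) (when-yes (p FinP.≟ p) refl _))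
      (trans (+-identityˡ _)
      (trans (cong₂ (λ x y → 𝟙 (x ∧ W p p) + 𝟙 (y ∧ W p p) + 𝟙 (x ∧ y)) (<ᵇ-irrefl (vlookup τ′ p)) (<ᵇ-irrefl p))
      (cong (+ 2 ℤ.*_) (sym (when-no (p Fin.<? p) p≮p _)))))
    ... | tri> p≮q p≢q _ =
      trans (cong₂ _+_ (when-no (p Fin.<? q) p≮q _) (when-no (p FinP.≟ q) p≢q _))
      (cong (+ 2 ℤ.*_) (sym (when-no (p Fin.<? q) p≮q _)))

    inversions-even : inversionsℤ (w ∘t τ) + inversionsℤ w + inversionsℤ τ ≡ + 2 ℤ.* ∑² n h
    inversions-even = begin
      inversionsℤ (w ∘t τ) + inversionsℤ w + inversionsℤ τ
        ≡⟨ cong₂ (λ x y → x + inversionsℤ w + y) inversions-w∘τ inversions-τ ⟩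
      ∑² n (λ p q → 𝟙 (A p q ∧ W p q)) + inversionsℤ w + ∑² n (λ p q → 𝟙 (A p q ∧ q <ᵇ p))
        ≡⟨ trans (cong (_+ ∑² n (λ p q → 𝟙 (A p q ∧ q <ᵇ p))) (sym (∑²-+ n _ _))) (sym (∑²-+ n _ _)) ⟩
      ∑² n H
        ≡⟨ ∑²-by-pairs n H ⟩
      ∑² n (λ p q → when (p Fin.<? q) (H p q + H q p) + when (p FinP.≟ q) (H p q))
        ≡⟨ ∑²-cong n pair-sum ⟩
      ∑² n (λ p q → + 2 ℤ.* h p q)
        ≡⟨ ∑²-*ˡ n (+ 2) h ⟩
      + 2 ℤ.* ∑² n h ∎
      where open ≡-Reasoning

  sgn-∘ : sgn (w ∘t τ) ≡ sgn w ℤ.* sgn τ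
  sgn-∘ = −1^-parity (inversions (w ∘t τ)) (inversions w) (inversions τ) (∑² n h)
    (trans (cong₂ (λ x y → x + y + + inversions τ) (inversions≡inversionsℤ (w ∘t τ)) (inversions≡inversionsℤ w))
    (trans (cong (_+_ (inversionsℤ (w ∘t τ) + inversionsℤ w)) (inversions≡inversionsℤ τ)) inversions-even))

module _ {n : ℕ} where

  transpose-at₁ : ∀ (x y : Fin n) → PC.transpose x y x ≡ y
  transpose-at₁ x y rewrite Dec.dec-true (x FinP.≟ x) refl = refl

  transpose-at₂ : ∀ (x y : Fin n) → PC.transpose x y y ≡ x
  transpose-at₂ x y with y FinP.≟ x
  ... | yes refl = refl
  ... | no _ rewrite Dec.dec-true (y FinP.≟ y) refl = refl

  transpose-fix : ∀ (x y k : Fin n) → ¬ k ≡ x → ¬ k ≡ y → PC.transpose x y k ≡ k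
  transpose-fix x y k k≢x k≢y rewrite Dec.dec-false (k FinP.≟ x) k≢x | Dec.dec-false (k FinP.≟ y) k≢y = refl

  transpose-cases : ∀ (x y k : Fin n) (P : Fin n → Fin n → Set) →
    (k ≡ x → P k y) → (¬ k ≡ x → k ≡ y → P k x) → (¬ k ≡ x → ¬ k ≡ y → P k k) → P k (PC.transpose x y k)
  transpose-cases x y k P at₁ at₂ fix = by-cases (k FinP.≟ x) (k FinP.≟ y)
    where
    by-cases : Dec (k ≡ x) → Dec (k ≡ y) → P k (PC.transpose x y k)
    by-cases (yes k≡x) _ = subst (P k) (sym (trans (cong (PC.transpose x y) k≡x) (transpose-at₁ x y))) (at₁ k≡x)
    by-cases (no k≢x) (yes k≡y) = subst (P k) (sym (trans (cong (PC.transpose x y) k≡y) (transpose-at₂ x y))) (at₂ k≢x k≡y)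
    by-cases (no k≢x) (no k≢y) = subst (P k) (sym (transpose-fix x y k k≢x k≢y)) (fix k≢x k≢y)

  transpose-involutive : ∀ (x y k : Fin n) → PC.transpose x y (PC.transpose x y k) ≡ k
  transpose-involutive x y k = transpose-cases x y k (λ k j → PC.transpose x y j ≡ k)
    (λ { refl → transpose-at₂ k y }) (λ _ → λ { refl → transpose-at₁ x k }) (transpose-fix x y k)

  transpose-comm : ∀ (x y k : Fin n) → PC.transpose x y k ≡ PC.transpose y x k
  transpose-comm x y k = transpose-cases x y k (λ k j → j ≡ PC.transpose y x k)
    (λ { refl → sym (transpose-at₂ y k) }) (λ _ → λ { refl → sym (transpose-at₁ k x) })
    (λ k≢x k≢y → sym (transpose-fix y x k k≢y k≢x))

  ⦅_⇄_⦆ : Fin n → Fin n → Tab n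
  ⦅ x ⇄ y ⦆ = Vec.tabulate (PC.transpose x y)

  lookup-⦅⇄⦆ : ∀ (x y k : Fin n) → vlookup ⦅ x ⇄ y ⦆ k ≡ PC.transpose x y k
  lookup-⦅⇄⦆ x y k = lookup∘tabulate _ k

  ⦅⇄⦆-self-inverse : ∀ (x y : Fin n) → AreInverse ⦅ x ⇄ y ⦆ ⦅ x ⇄ y ⦆
  ⦅⇄⦆-self-inverse x y = involutive , involutive
    where
    involutive : ∀ k → vlookup ⦅ x ⇄ y ⦆ (vlookup ⦅ x ⇄ y ⦆ k) ≡ k
    involutive k = trans (lookup-⦅⇄⦆ x y _) (trans (cong (PC.transpose x y) (lookup-⦅⇄⦆ x y k)) (transpose-involutive x y k))

  ⦅⇄⦆-isPerm : ∀ (x y : Fin n) → IsPerm ⦅ x ⇄ y ⦆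
  ⦅⇄⦆-isPerm x y = AreInverse⇒IsPerm (⦅⇄⦆-self-inverse x y)

  ⦅⇄⦆-∘-lookup : ∀ (x y : Fin n) (u : Tab n) k → vlookup (⦅ x ⇄ y ⦆ ∘t u) k ≡ PC.transpose x y (vlookup u k)
  ⦅⇄⦆-∘-lookup x y u k = trans (lookup-∘t ⦅ x ⇄ y ⦆ u k) (lookup-⦅⇄⦆ x y (vlookup u k))

  ⦅⇄⦆-∘-cancel : ∀ (x y : Fin n) (u : Tab n) → ⦅ x ⇄ y ⦆ ∘t (⦅ x ⇄ y ⦆ ∘t u) ≡ u
  ⦅⇄⦆-∘-cancel x y u = tab-ext λ k → trans (lookup-∘t ⦅ x ⇄ y ⦆ (⦅ x ⇄ y ⦆ ∘t u) k)
    (trans (cong (vlookup ⦅ x ⇄ y ⦆) (lookup-∘t ⦅ x ⇄ y ⦆ u k)) (AreInverse.left-inverse (⦅⇄⦆-self-inverse x y) _))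

  ∘⦅⇄⦆-cancel : ∀ (x y : Fin n) (w : Tab n) → (w ∘t ⦅ x ⇄ y ⦆) ∘t ⦅ x ⇄ y ⦆ ≡ w
  ∘⦅⇄⦆-cancel x y w = tab-ext λ k → trans (lookup-∘t (w ∘t ⦅ x ⇄ y ⦆) ⦅ x ⇄ y ⦆ k)
    (trans (lookup-∘t w ⦅ x ⇄ y ⦆ (vlookup ⦅ x ⇄ y ⦆ k)) (cong (vlookup w) (AreInverse.left-inverse (⦅⇄⦆-self-inverse x y) k)))

module Adjacent {n : ℕ} (a a′ : Fin n) (a′≡1+a : toℕ a′ ≡ ℕ.suc (toℕ a)) where

  private
    s : Fin n → Fin n
    s = PC.transpose a a′

    a<a′ : a Fin.< a′
    a<a′ = subst (toℕ a ℕ.<_) (sym a′≡1+a) (ℕP.n<1+n (toℕ a))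

    nothing-between : ∀ (k : Fin n) → a Fin.< k → k Fin.< a′ → ⊥
    nothing-between k a<k k<a′ = ℕP.<-irrefl refl (ℕP.<-≤-trans a<k (ℕP.≤-pred (subst (toℕ k ℕ.<_) a′≡1+a k<a′)))

    from-a : ∀ q → ¬ q ≡ a′ → 𝟙 (a <ᵇ q ∧ s q <ᵇ s a) ≡ 0ℤ
    from-a q q≢a′ = subst (λ z → 𝟙 (a <ᵇ q ∧ s q <ᵇ z) ≡ 0ℤ) (sym (transpose-at₁ a a′))
      (transpose-cases a a′ q (λ q j → 𝟙 (a <ᵇ q ∧ j <ᵇ a′) ≡ 0ℤ)
        (λ q≡a → cong (λ c → 𝟙 (c ∧ a′ <ᵇ a′)) (trans (cong (a <ᵇ_) q≡a) (<ᵇ-irrefl a)))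
        (λ _ q≡a′ → ⊥-elim (q≢a′ q≡a′))
        (λ _ _ → 𝟙-both-false a q q a′ (nothing-between q)))

    to-a′ : ∀ p → ¬ p ≡ a → 𝟙 (p <ᵇ a′ ∧ s a′ <ᵇ s p) ≡ 0ℤ
    to-a′ p p≢a = subst (λ z → 𝟙 (p <ᵇ a′ ∧ z <ᵇ s p) ≡ 0ℤ) (sym (transpose-at₂ a a′))
      (transpose-cases a a′ p (λ p j → 𝟙 (p <ᵇ a′ ∧ a <ᵇ j) ≡ 0ℤ)
        (λ p≡a → ⊥-elim (p≢a p≡a))
        (λ _ p≡a′ → cong (λ c → 𝟙 (c ∧ a <ᵇ a)) (trans (cong (_<ᵇ a′) p≡a′) (<ᵇ-irrefl a′)))
        (λ _ _ → 𝟙-both-false p a′ a p (λ p<a′ a<p → nothing-between p a<p p<a′)))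

    elsewhere : ∀ p q → ¬ p ≡ a → ¬ q ≡ a′ → 𝟙 (p <ᵇ q ∧ s q <ᵇ s p) ≡ 0ℤ
    elsewhere p q p≢a q≢a′ = transpose-cases a a′ q (λ q j → 𝟙 (p <ᵇ q ∧ j <ᵇ s p) ≡ 0ℤ)
      (λ { refl → transpose-cases a a′ p (λ p j → 𝟙 (p <ᵇ a ∧ a′ <ᵇ j) ≡ 0ℤ)
          (λ p≡a → ⊥-elim (p≢a p≡a))
          (λ { _ refl → cong (λ c → 𝟙 (c ∧ a′ <ᵇ a)) (<ᵇ-false (ℕP.<-asym a<a′)) })
          (λ _ _ → 𝟙-both-false p a a′ p λ p<a a′<p → ℕP.<-asym p<a (ℕP.<-trans a<a′ a′<p)) })
      (λ _ q≡a′ → ⊥-elim (q≢a′ q≡a′))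
      (λ _ _ → transpose-cases a a′ p (λ p j → 𝟙 (p <ᵇ q ∧ q <ᵇ j) ≡ 0ℤ)
          (λ p≡a → ⊥-elim (p≢a p≡a))
          (λ { _ refl → 𝟙-both-false a′ q q a λ a′<q q<a → ℕP.<-asym q<a (ℕP.<-trans a<a′ a′<q) })
          (λ _ _ → 𝟙-both-false p q q p ℕP.<-asym))

    only-pair : ∀ p q → 𝟙 (p <ᵇ q ∧ s q <ᵇ s p) ≡ when (p FinP.≟ a) (when (q FinP.≟ a′) 1ℤ)
    only-pair p q = by-cases (p FinP.≟ a) (q FinP.≟ a′)
      where
      by-cases : (p≟a : Dec (p ≡ a)) (q≟a′ : Dec (q ≡ a′)) → 𝟙 (p <ᵇ q ∧ s q <ᵇ s p) ≡ when p≟a (when q≟a′ 1ℤ)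
      by-cases (yes refl) (yes refl) = cong₂ (λ c d → 𝟙 (c ∧ d)) (<ᵇ-true a<a′)
                                         (trans (cong₂ _<ᵇ_ (transpose-at₂ a a′) (transpose-at₁ a a′)) (<ᵇ-true a<a′))
      by-cases (yes refl) (no q≢a′) = from-a q q≢a′
      by-cases (no p≢a) (yes refl) = to-a′ p p≢a
      by-cases (no p≢a) (no q≢a′) = elsewhere p q p≢a q≢a′

  inversions-adjacent : inversionsℤ ⦅ a ⇄ a′ ⦆ ≡ 1ℤ
  inversions-adjacent =
    trans (∑²-cong n (λ p q → cong₂ (λ x y → 𝟙 (p <ᵇ q ∧ x <ᵇ y)) (lookup-⦅⇄⦆ a a′ q) (lookup-⦅⇄⦆ a a′ p)))
    (trans (∑²-cong n only-pair)
    (trans (∑-cong (allFin n) (λ p → ∑-when (p FinP.≟ a) (allFin n) _))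
    (trans (∑-cong (allFin n) (λ p → cong (when (p FinP.≟ a)) (∑-when≟ (λ _ → 1ℤ) a′)))
      (∑-when≟ (λ _ → 1ℤ) a))))
    where open Enumerates (allFin-enumerates n)

  sgn-adjacent : sgn ⦅ a ⇄ a′ ⦆ ≡ -1ℤ
  sgn-adjacent = cong −1^ (+-injective (trans (inversions≡inversionsℤ ⦅ a ⇄ a′ ⦆) inversions-adjacent))

module _ {n : ℕ} where

  transpose-conjugate : ∀ (a a′ b k : Fin n) → ¬ a ≡ a′ → ¬ a′ ≡ b → ¬ a ≡ b →
    PC.transpose a a′ (PC.transpose a′ b (PC.transpose a a′ k)) ≡ PC.transpose a b k
  transpose-conjugate a a′ b k a≢a′ a′≢b a≢b = by-cases (k FinP.≟ a) (k FinP.≟ a′) (k FinP.≟ b)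
    where
    s t : Fin n → Fin n
    s = PC.transpose a a′
    t = PC.transpose a′ b
    by-cases : Dec (k ≡ a) → Dec (k ≡ a′) → Dec (k ≡ b) → s (t (s k)) ≡ PC.transpose a b k
    by-cases (yes refl) _ _ =
      trans (cong (s ∘ t) (transpose-at₁ a a′))
      (trans (cong s (transpose-at₁ a′ b))
      (trans (transpose-fix a a′ b (a≢b ∘ sym) (a′≢b ∘ sym)) (sym (transpose-at₁ a b))))
    by-cases (no _) (yes refl) _ =
      trans (cong (s ∘ t) (transpose-at₂ a a′))
      (trans (cong s (transpose-fix a′ b a a≢a′ a≢b))
      (trans (transpose-at₁ a a′) (sym (transpose-fix a b a′ (a≢a′ ∘ sym) a′≢b))))
    by-cases (no k≢a) (no k≢a′) (yes refl) =
      trans (cong (s ∘ t) (transpose-fix a a′ b k≢a k≢a′))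
      (trans (cong s (transpose-at₂ a′ b)) (trans (transpose-at₂ a a′) (sym (transpose-at₂ a b))))
    by-cases (no k≢a) (no k≢a′) (no k≢b) =
      trans (cong (s ∘ t) (transpose-fix a a′ k k≢a k≢a′))
      (trans (cong s (transpose-fix a′ b k k≢a′ k≢b))
      (trans (transpose-fix a a′ k k≢a k≢a′) (sym (transpose-fix a b k k≢a k≢b))))

  sgn-⦅⇄⦆-at-distance : ∀ d (a b : Fin n) → toℕ b ≡ ℕ.suc (toℕ a) ℕ.+ d → sgn ⦅ a ⇄ b ⦆ ≡ -1ℤ
  sgn-⦅⇄⦆-at-distance ℕ.zero a b b≡1+a = Adjacent.sgn-adjacent a b (trans b≡1+a (ℕP.+-identityʳ _))
  sgn-⦅⇄⦆-at-distance (ℕ.suc d) a b b≡1+a+1+d = begin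
    sgn ⦅ a ⇄ b ⦆                 ≡⟨ cong sgn (tab-ext {π = ⦅ a ⇄ b ⦆} {s ∘t (t ∘t s)} conjugate) ⟩
    sgn (s ∘t (t ∘t s))            ≡⟨ sgn-∘ s (t ∘t s) (s ∘t t) (⦅⇄⦆-isPerm a a′)
                                              (AreInverse-∘ (⦅⇄⦆-self-inverse a′ b) (⦅⇄⦆-self-inverse a a′)) ⟩
    sgn s ℤ.* sgn (t ∘t s)         ≡⟨ cong (sgn s ℤ.*_) (sgn-∘ t s s (⦅⇄⦆-isPerm a′ b) (⦅⇄⦆-self-inverse a a′)) ⟩
    sgn s ℤ.* (sgn t ℤ.* sgn s)    ≡⟨ cong₂ (λ x y → x ℤ.* (y ℤ.* x)) (Adjacent.sgn-adjacent a a′ a′≡1+a)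
                                                                  (sgn-⦅⇄⦆-at-distance d a′ b b≡1+a′+d) ⟩
    -1ℤ                            ∎
    where
    open ≡-Reasoning
    1+a<n : ℕ.suc (toℕ a) ℕ.< n
    1+a<n = ℕP.<-trans (subst (ℕ.suc (toℕ a) ℕ.<_) (sym b≡1+a+1+d) (ℕP.m<m+n _ (ℕ.s≤s ℕ.z≤n))) (FinP.toℕ<n b)
    a′ : Fin n
    a′ = Fin.fromℕ< 1+a<n
    a′≡1+a : toℕ a′ ≡ ℕ.suc (toℕ a)
    a′≡1+a = FinP.toℕ-fromℕ< 1+a<n
    b≡1+a′+d : toℕ b ≡ ℕ.suc (toℕ a′) ℕ.+ d
    b≡1+a′+d = trans b≡1+a+1+d (trans (ℕP.+-suc (ℕ.suc (toℕ a)) d) (cong (λ z → ℕ.suc z ℕ.+ d) (sym a′≡1+a)))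
    s t : Tab n
    s = ⦅ a ⇄ a′ ⦆
    t = ⦅ a′ ⇄ b ⦆
    a≢a′ : ¬ a ≡ a′
    a≢a′ a≡a′ = ℕP.<-irrefl (trans (cong toℕ a≡a′) a′≡1+a) (ℕP.n<1+n _)
    a′≢b : ¬ a′ ≡ b
    a′≢b a′≡b = ℕP.<-irrefl (trans (cong toℕ a′≡b) b≡1+a′+d) (ℕP.<-≤-trans (ℕP.n<1+n _) (ℕP.m≤m+n _ d))
    a≢b : ¬ a ≡ b
    a≢b a≡b = ℕP.<-irrefl (trans (cong toℕ a≡b) b≡1+a+1+d) (ℕP.<-≤-trans (ℕP.n<1+n _) (ℕP.m≤m+n _ (ℕ.suc d)))
    conjugate : ∀ k → vlookup ⦅ a ⇄ b ⦆ k ≡ vlookup (s ∘t (t ∘t s)) k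
    conjugate k = sym (begin
      vlookup (s ∘t (t ∘t s)) k                           ≡⟨ lookup-∘t s (t ∘t s) k ⟩
      vlookup s (vlookup (t ∘t s) k)                       ≡⟨ cong (vlookup s) (lookup-∘t t s k) ⟩
      vlookup s (vlookup t (vlookup s k))                  ≡⟨ lookup-⦅⇄⦆ a a′ _ ⟩
      PC.transpose a a′ (vlookup t (vlookup s k))          ≡⟨ cong (PC.transpose a a′) (lookup-⦅⇄⦆ a′ b _) ⟩
      PC.transpose a a′ (PC.transpose a′ b (vlookup s k))  ≡⟨ cong (PC.transpose a a′ ∘ PC.transpose a′ b) (lookup-⦅⇄⦆ a a′ k) ⟩
      PC.transpose a a′ (PC.transpose a′ b (PC.transpose a a′ k))
                                                           ≡⟨ transpose-conjugate a a′ b k a≢a′ a′≢b a≢b ⟩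
      PC.transpose a b k                                   ≡⟨ lookup-⦅⇄⦆ a b k ⟨
      vlookup ⦅ a ⇄ b ⦆ k                                  ∎)

  sgn-⦅⇄⦆ : ∀ (a b : Fin n) → ¬ a ≡ b → sgn ⦅ a ⇄ b ⦆ ≡ -1ℤ
  sgn-⦅⇄⦆ a b a≢b with FinP.<-cmp a b
  ... | tri< a<b _ _ = sgn-⦅⇄⦆-at-distance (toℕ b ℕ.∸ ℕ.suc (toℕ a)) a b (sym (ℕP.m+[n∸m]≡n a<b))
  ... | tri≈ _ a≡b _ = ⊥-elim (a≢b a≡b)
  ... | tri> _ _ b<a = trans (cong sgn (tab-ext {π = ⦅ a ⇄ b ⦆} {⦅ b ⇄ a ⦆} λ k → trans (lookup-⦅⇄⦆ a b k) (trans (transpose-comm a b k) (sym (lookup-⦅⇄⦆ b a k)))))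
                             (sgn-⦅⇄⦆-at-distance (toℕ a ℕ.∸ ℕ.suc (toℕ b)) b a (sym (ℕP.m+[n∸m]≡n b<a)))

  sgn-∘⦅⇄⦆ : ∀ (w : Tab n) (x y : Fin n) → IsPerm w → ¬ x ≡ y → sgn (w ∘t ⦅ x ⇄ y ⦆) ≡ - sgn w
  sgn-∘⦅⇄⦆ w x y w-perm x≢y = begin
    sgn (w ∘t ⦅ x ⇄ y ⦆)     ≡⟨ sgn-∘ w ⦅ x ⇄ y ⦆ ⦅ x ⇄ y ⦆ w-perm (⦅⇄⦆-self-inverse x y) ⟩
    sgn w ℤ.* sgn ⦅ x ⇄ y ⦆  ≡⟨ cong (sgn w ℤ.*_) (sgn-⦅⇄⦆ x y x≢y) ⟩
    sgn w ℤ.* -1ℤ           ≡⟨ trans (*-comm (sgn w) -1ℤ) (-1*i≡-i (sgn w)) ⟩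
    - sgn w                 ∎
    where open ≡-Reasoning

-- Exchanging entries between rows i and i+1

_∈ᵇ_ : ∀ {n} → Fin n → List (Fin n) → Bool
k ∈ᵇ [] = false
k ∈ᵇ (z ∷ zs) = does (k FinP.≟ z) ∨ k ∈ᵇ zs

Distinct : ∀ {n} → List (Fin n) → Set
Distinct [] = ⊤
Distinct (x ∷ xs) = x ∈ᵇ xs ≡ false × Distinct xs

module _ {n : ℕ} where

  ∈ᵇ-there : ∀ (k x : Fin n) xs → k ∈ᵇ xs ≡ true → k ∈ᵇ (x ∷ xs) ≡ true
  ∈ᵇ-there k x xs k∈xs = trans (cong (does (k FinP.≟ x) ∨_) k∈xs) (BoolP.∨-zeroʳ _)

  ∈ᵇ-here : ∀ (x : Fin n) xs → x ∈ᵇ (x ∷ xs) ≡ true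
  ∈ᵇ-here x xs rewrite Dec.dec-true (x FinP.≟ x) refl = refl

  count : Fin n → List (Fin n) → ℕ
  count k [] = 0
  count k (x ∷ xs) = if does (x FinP.≟ k) then ℕ.suc (count k xs) else count k xs

  countℤ : Fin n → List (Fin n) → ℤ
  countℤ k L = ∑ L (λ z → when (z FinP.≟ k) 1ℤ)

  count≡countℤ : ∀ (k : Fin n) L → + count k L ≡ countℤ k L
  count≡countℤ k [] = refl
  count≡countℤ k (x ∷ xs) with x FinP.≟ k
  ... | yes _ = cong (_+_ 1ℤ) (count≡countℤ k xs)
  ... | no _ = trans (count≡countℤ k xs) (sym (+-identityˡ _))

  ∉ᵇ⇒count≡0 : ∀ (k : Fin n) L → k ∈ᵇ L ≡ false → count k L ≡ 0
  ∉ᵇ⇒count≡0 k [] _ = refl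
  ∉ᵇ⇒count≡0 k (x ∷ xs) k∉L with x FinP.≟ k | k FinP.≟ x
  ... | yes refl | yes _ = contradiction k∉L λ ()
  ... | yes refl | no k≢k = ⊥-elim (k≢k refl)
  ... | no _ | yes refl = contradiction k∉L λ ()
  ... | no _ | no _ = ∉ᵇ⇒count≡0 k xs k∉L

  ∈ᵇ⇒count≥1 : ∀ (k : Fin n) L → k ∈ᵇ L ≡ true → 1 ℕ.≤ count k L
  ∈ᵇ⇒count≥1 k (x ∷ xs) k∈L with x FinP.≟ k | k FinP.≟ x
  ... | yes _ | _ = ℕ.s≤s ℕ.z≤n
  ... | no x≢x | yes refl = ⊥-elim (x≢x refl)
  ... | no _ | no _ = ∈ᵇ⇒count≥1 k xs k∈L

  count≤1⇒Distinct : ∀ (L : List (Fin n)) → (∀ k → count k L ℕ.≤ 1) → Distinct L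
  count≤1⇒Distinct [] _ = tt
  count≤1⇒Distinct (x ∷ xs) count≤1 = x∉xs , count≤1⇒Distinct xs count≤1-tail
    where
    count-head : count x (x ∷ xs) ≡ ℕ.suc (count x xs)
    count-head rewrite Dec.dec-true (x FinP.≟ x) refl = refl
    x∉xs : x ∈ᵇ xs ≡ false
    x∉xs with x ∈ᵇ xs in x∈xs
    ... | false = refl
    ... | true = ⊥-elim (ℕP.<-irrefl refl (ℕP.≤-trans (ℕ.s≤s (∈ᵇ⇒count≥1 x xs x∈xs)) (subst (ℕ._≤ 1) count-head (count≤1 x))))
    count≤1-tail : ∀ k → count k xs ℕ.≤ 1
    count≤1-tail k with x FinP.≟ k | count≤1 k
    ... | yes _ | c≤1 = ℕP.≤-trans (ℕP.n≤1+n _) c≤1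
    ... | no _ | c≤1 = c≤1

  length≡∑countℤ : ∀ (L : List (Fin n)) → + List.length L ≡ ∑ (allFin n) (λ k → countℤ k L)
  length≡∑countℤ L = trans (length≡∑1 L)
    (trans (∑-cong L (λ z → sym (∑-whenˡ FinP._≟_ (allFin-enumerates n) (λ _ → 1ℤ) z))) (∑-swap L (allFin n) _))
    where
    length≡∑1 : ∀ (L : List (Fin n)) → + List.length L ≡ ∑ L (λ _ → 1ℤ)
    length≡∑1 [] = refl
    length≡∑1 (x ∷ xs) = cong (_+_ 1ℤ) (length≡∑1 xs)

module _ {n : ℕ} {λ′ : Partition n} (S : Numbering λ′) where

  ∑-row-when≟ : ∀ r k X →
    ∑ (allFin (List.lookup (parts λ′) r)) (λ c → when (entry S (r , c) FinP.≟ k) X) ≡ when (rowOf S k FinP.≟ r) X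
  ∑-row-when≟ r k X with rowOf S k FinP.≟ r
  ... | yes refl = trans (∑-supported FinP._≟_ (allFin-enumerates _) _ c (λ c′ c′≢c → when-no (entry S (r , c′) FinP.≟ k) (other c′ c′≢c) X))
                         (when-yes (entry S (r , c) FinP.≟ k) (trans (cong (entry S) (sym pos≡)) (entry-pos S k)) X)
    where
    c = proj₂ (pos S k)
    pos≡ : pos S k ≡ (r , c)
    pos≡ = refl
    other : ∀ c′ → ¬ c′ ≡ c → ¬ entry S (r , c′) ≡ k
    other c′ c′≢c e = c′≢c (,-injectiveʳ (trans (sym (pos-entry S (r , c′))) (cong (pos S) e)))
  ... | no row≢r = trans (∑-cong (allFin _) (λ c → when-no (entry S (r , c) FinP.≟ k) (not-in-row c) X)) (∑-zero (allFin (List.lookup (parts λ′) r)))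
    where
    not-in-row : ∀ c → ¬ entry S (r , c) ≡ k
    not-in-row c e = row≢r (trans (cong (rowOf S) (sym e)) (cong proj₁ (pos-entry S (r , c))))

  InRowᵇ : ℕ → Subset n → Fin n → Bool
  InRowᵇ j A k = does (k ∈? A) ∧ does (toℕ (rowOf S k) ℕ.≟ j)

  countℤ-ordered : ∀ j A k → countℤ k (ordered S j A) ≡ 𝟙 (InRowᵇ j A k)
  countℤ-ordered j A k =
    trans (∑-concatMap _ (allFin (ℓ λ′)) _)
    (trans (∑-cong (allFin (ℓ λ′)) (λ r → trans (∑-if (toℕ r ℕ.≟ j) _ _)
              (cong (when (toℕ r ℕ.≟ j)) (trans (∑-filter (_∈? A) (rowEntries S r) _)
                 (trans (∑-map (λ c → entry S (r , c)) (allFin _) _)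
                 (trans (∑-cong (allFin _) (λ c → when-∈-≟ (entry S (r , c))))
                 (∑-row-when≟ r k _)))))))
    (trans (∑-cong (allFin (ℓ λ′)) (λ r → when-comm (toℕ r ℕ.≟ j) (rowOf S k FinP.≟ r) _))
    (trans (∑-whenˡ FinP._≟_ (allFin-enumerates _) (λ r → when (toℕ r ℕ.≟ j) (when (k ∈? A) 1ℤ)) (rowOf S k))
    (when²≡𝟙∧ (toℕ (rowOf S k) ℕ.≟ j) (k ∈? A)))))
    where
    ∑-if : ∀ {P : Set} (d : Dec P) (L : List (Fin n)) f → ∑ (if Dec.⌊ d ⌋ then L else []) f ≡ when d (∑ L f)
    ∑-if (yes _) L f = refl
    ∑-if (no _) L f = refl
    when-∈-≟ : ∀ e → when (e ∈? A) (when (e FinP.≟ k) 1ℤ) ≡ when (e FinP.≟ k) (when (k ∈? A) 1ℤ)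
    when-∈-≟ e with e FinP.≟ k
    ... | yes refl = refl
    ... | no _ = when-0 (e ∈? A)
    when²≡𝟙∧ : ∀ {P P′ : Set} (d : Dec P) (d′ : Dec P′) → when d (when d′ 1ℤ) ≡ 𝟙 (does d′ ∧ does d)
    when²≡𝟙∧ (yes _) (yes _) = refl
    when²≡𝟙∧ (yes _) (no _) = refl
    when²≡𝟙∧ (no _) (yes _) = refl
    when²≡𝟙∧ (no _) (no _) = refl

  count-ordered : ∀ j A k → count k (ordered S j A) ≡ (if InRowᵇ j A k then 1 else 0)
  count-ordered j A k = +-injective (trans (count≡countℤ k (ordered S j A)) (trans (countℤ-ordered j A k) (𝟙≡+ (InRowᵇ j A k))))
    where
    𝟙≡+ : ∀ b → 𝟙 b ≡ + (if b then 1 else 0)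
    𝟙≡+ true = refl
    𝟙≡+ false = refl

  ∈ᵇ-ordered : ∀ j A k → k ∈ᵇ ordered S j A ≡ InRowᵇ j A k
  ∈ᵇ-ordered j A k with InRowᵇ j A k in eb | k ∈ᵇ ordered S j A in em
  ... | true | true = refl
  ... | false | false = refl
  ... | true | false = ⊥-elim (ℕP.1+n≢0 (trans (sym (trans (count-ordered j A k) (cong (λ b → if b then 1 else 0) eb)))
                                               (∉ᵇ⇒count≡0 k (ordered S j A) em)))
  ... | false | true = ⊥-elim (ℕP.<-irrefl refl (subst (1 ℕ.≤_) (trans (count-ordered j A k) (cong (λ b → if b then 1 else 0) eb))
                                                        (∈ᵇ⇒count≥1 k (ordered S j A) em)))

  ordered-distinct : ∀ j A → Distinct (ordered S j A)
  ordered-distinct j A = count≤1⇒Distinct (ordered S j A) λ k → subst (ℕ._≤ 1) (sym (count-ordered j A k)) (indicator≤1 (InRowᵇ j A k))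
    where
    indicator≤1 : ∀ b → (if b then 1 else 0) ℕ.≤ 1
    indicator≤1 true = ℕP.≤-refl
    indicator≤1 false = ℕ.z≤n

  length-ordered : ∀ j A → InRow S j A → List.length (ordered S j A) ≡ ∣ A ∣
  length-ordered j A A-in-row = +-injective (trans (length≡∑countℤ (ordered S j A))
    (trans (∑-cong (allFin n) (λ k → trans (countℤ-ordered j A k) (cong 𝟙 (does-∧-implied (k ∈? A) (toℕ (rowOf S k) ℕ.≟ j) (A-in-row k)))))
    (sym (∣∣≡∑ A))))

module _ {n : ℕ} (i : ℕ) where

  swappedRow : List (Fin n) → List (Fin n) → (Fin n → ℕ) → Fin n → ℕ
  swappedRow L₁ L₂ f k = if k ∈ᵇ L₁ then i else if k ∈ᵇ L₂ then ℕ.suc i else f k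

  swappedRow-∷ : ∀ (f : Fin n → ℕ) x y xs ys → x ∈ᵇ xs ≡ false → y ∈ᵇ ys ≡ false →
    (∀ a → a ∈ᵇ (x ∷ xs) ≡ true → f a ≡ ℕ.suc i) → (∀ b → b ∈ᵇ (y ∷ ys) ≡ true → f b ≡ i) →
    ∀ k → swappedRow xs ys (f ∘ PC.transpose y x) k ≡ swappedRow (x ∷ xs) (y ∷ ys) f k
  swappedRow-∷ f x y xs ys x∉xs y∉ys on-L₁ on-L₂ k = by-cases (k FinP.≟ x) (k FinP.≟ y)
    where
    fx : f x ≡ ℕ.suc i
    fx = on-L₁ x (∈ᵇ-here x xs)
    fy : f y ≡ i
    fy = on-L₂ y (∈ᵇ-here y ys)
    row-i⇒∉xs : ∀ z → f z ≡ i → z ∈ᵇ xs ≡ false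
    row-i⇒∉xs z fz with z ∈ᵇ xs in z∈xs
    ... | true = ⊥-elim (ℕP.1+n≢n (trans (sym (on-L₁ z (∈ᵇ-there z x xs z∈xs))) fz))
    ... | false = refl
    row-1+i⇒∉ys : ∀ z → f z ≡ ℕ.suc i → z ∈ᵇ ys ≡ false
    row-1+i⇒∉ys z fz with z ∈ᵇ ys in z∈ys
    ... | true = ⊥-elim (ℕP.1+n≢n (trans (sym fz) (on-L₂ z (∈ᵇ-there z y ys z∈ys))))
    ... | false = refl
    if₂ : Bool → Bool → ℕ → ℕ
    if₂ b c z = if b then i else if c then ℕ.suc i else z
    by-cases : Dec (k ≡ x) → Dec (k ≡ y) → if₂ (k ∈ᵇ xs) (k ∈ᵇ ys) (f (PC.transpose y x k)) ≡ if₂ (k ∈ᵇ (x ∷ xs)) (k ∈ᵇ (y ∷ ys)) (f k)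
    by-cases (yes refl) _ = begin
      if₂ (k ∈ᵇ xs) (k ∈ᵇ ys) (f (PC.transpose y k k))  ≡⟨ cong₂ (λ b c → if₂ b c (f (PC.transpose y k k))) x∉xs (row-1+i⇒∉ys k fx) ⟩
      f (PC.transpose y k k)                             ≡⟨ cong f (transpose-at₂ y k) ⟩
      f y                                                ≡⟨ fy ⟩
      i                                                  ≡⟨ cong (λ b → if₂ b (k ∈ᵇ (y ∷ ys)) (f k)) (∈ᵇ-here k xs) ⟨
      if₂ (k ∈ᵇ (k ∷ xs)) (k ∈ᵇ (y ∷ ys)) (f k)         ∎
      where open ≡-Reasoning
    by-cases (no k≢x) (yes refl) = begin
      if₂ (k ∈ᵇ xs) (k ∈ᵇ ys) (f (PC.transpose k x k))  ≡⟨ cong₂ (λ b c → if₂ b c (f (PC.transpose k x k))) (row-i⇒∉xs k fy) y∉ys ⟩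
      f (PC.transpose k x k)                             ≡⟨ cong f (transpose-at₁ k x) ⟩
      f x                                                ≡⟨ fx ⟩
      ℕ.suc i                                            ≡⟨ cong₂ (λ b c → if₂ b c (f k))
                                                              (cong₂ _∨_ (Dec.dec-false (k FinP.≟ x) k≢x) (row-i⇒∉xs k fy)) (∈ᵇ-here k ys) ⟨
      if₂ (k ∈ᵇ (x ∷ xs)) (k ∈ᵇ (k ∷ ys)) (f k)         ∎
      where open ≡-Reasoning
    by-cases (no k≢x) (no k≢y) =
      trans (cong (if₂ (k ∈ᵇ xs) (k ∈ᵇ ys)) (cong f (transpose-fix y x k k≢y k≢x)))
      (cong₂ (λ b c → if₂ b c (f k)) (cong (_∨ k ∈ᵇ xs) (sym (Dec.dec-false (k FinP.≟ x) k≢x)))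
                                      (cong (_∨ k ∈ᵇ ys) (sym (Dec.dec-false (k FinP.≟ y) k≢y))))

  -- f plays the role of rowOf S: the entries of L₁ sit in row i+1, those of L₂ in row i.
  swaps-row : ∀ (f : Fin n → ℕ) L₁ L₂ → List.length L₁ ≡ List.length L₂ → Distinct L₁ → Distinct L₂ →
    (∀ a → a ∈ᵇ L₁ ≡ true → f a ≡ ℕ.suc i) → (∀ b → b ∈ᵇ L₂ ≡ true → f b ≡ i) →
    ∀ k → f (swaps (zip L₁ L₂) ⟨$⟩ˡ k) ≡ swappedRow L₁ L₂ f k
  swaps-row f [] [] _ _ _ _ _ k = refl
  swaps-row f (x ∷ xs) (y ∷ ys) |xs|≡|ys| (x∉xs , xs-distinct) (y∉ys , ys-distinct) on-L₁ on-L₂ k =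
    trans (swaps-row (f ∘ PC.transpose y x) xs ys (ℕP.suc-injective |xs|≡|ys|) xs-distinct ys-distinct on-xs on-ys k)
          (swappedRow-∷ f x y xs ys x∉xs y∉ys on-L₁ on-L₂ k)
    where
    on-xs : ∀ a → a ∈ᵇ xs ≡ true → f (PC.transpose y x a) ≡ ℕ.suc i
    on-xs a a∈xs = trans (cong f (transpose-fix y x a
        (λ a≡y → ℕP.1+n≢n (trans (sym (on-L₁ a (∈ᵇ-there a x xs a∈xs))) (trans (cong f a≡y) (on-L₂ y (∈ᵇ-here y ys)))))
        (λ a≡x → contradiction (trans (sym a∈xs) (trans (cong (_∈ᵇ xs) a≡x) x∉xs)) λ ())))
      (on-L₁ a (∈ᵇ-there a x xs a∈xs))
    on-ys : ∀ b → b ∈ᵇ ys ≡ true → f (PC.transpose y x b) ≡ i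
    on-ys b b∈ys = trans (cong f (transpose-fix y x b
        (λ b≡y → contradiction (trans (sym b∈ys) (trans (cong (_∈ᵇ ys) b≡y) y∉ys)) λ ())
        (λ b≡x → ℕP.1+n≢n (trans (sym (on-L₁ x (∈ᵇ-here x xs))) (trans (cong f (sym b≡x)) (on-L₂ b (∈ᵇ-there b y ys b∈ys)))))))
      (on-L₂ b (∈ᵇ-there b y ys b∈ys))

module _ {n : ℕ} {λ′ : Partition n} (S : Numbering λ′) (i : ℕ) where

  exchangedRow : Subset n → Subset n → Fin n → ℕ
  exchangedRow A B k = if does (k ∈? A) then i else if does (k ∈? B) then ℕ.suc i else toℕ (rowOf S k)

  rowOf-exchange : ∀ A B → InRow S (ℕ.suc i) A → InRow S i B → ∣ A ∣ ≡ ∣ B ∣ →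
                   ∀ k → toℕ (rowOf (exchange S i A B) k) ≡ exchangedRow A B k
  rowOf-exchange A B A-in-row B-in-row |A|≡|B| k =
    trans (swaps-row i (toℕ ∘ rowOf S) L₁ L₂ |L₁|≡|L₂| (ordered-distinct S (ℕ.suc i) A) (ordered-distinct S i B) on-L₁ on-L₂ k)
          (cong₂ (λ b c → if b then i else if c then ℕ.suc i else toℕ (rowOf S k)) (∈ᵇ-L₁ k) (∈ᵇ-L₂ k))
    where
    L₁ = ordered S (ℕ.suc i) A
    L₂ = ordered S i B
    |L₁|≡|L₂| : List.length L₁ ≡ List.length L₂
    |L₁|≡|L₂| = trans (length-ordered S (ℕ.suc i) A A-in-row) (trans |A|≡|B| (sym (length-ordered S i B B-in-row)))
    ∈ᵇ-L₁ : ∀ a → a ∈ᵇ L₁ ≡ does (a ∈? A)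
    ∈ᵇ-L₁ a = trans (∈ᵇ-ordered S (ℕ.suc i) A a) (does-∧-implied (a ∈? A) (toℕ (rowOf S a) ℕ.≟ ℕ.suc i) (A-in-row a))
    ∈ᵇ-L₂ : ∀ b → b ∈ᵇ L₂ ≡ does (b ∈? B)
    ∈ᵇ-L₂ b = trans (∈ᵇ-ordered S i B b) (does-∧-implied (b ∈? B) (toℕ (rowOf S b) ℕ.≟ i) (B-in-row b))
    on-L₁ : ∀ a → a ∈ᵇ L₁ ≡ true → toℕ (rowOf S a) ≡ ℕ.suc i
    on-L₁ a a∈L₁ = A-in-row a (does≡true⇒ (a ∈? A) (trans (sym (∈ᵇ-L₁ a)) a∈L₁))
    on-L₂ : ∀ b → b ∈ᵇ L₂ ≡ true → toℕ (rowOf S b) ≡ i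
    on-L₂ b b∈L₂ = B-in-row b (does≡true⇒ (b ∈? B) (trans (sym (∈ᵇ-L₂ b)) b∈L₂))

  exchangedRow-∈₁ : ∀ {A B k} → k ∈ A → exchangedRow A B k ≡ i
  exchangedRow-∈₁ {A} {B} {k} k∈A = cong (λ c → if c then i else _) (Dec.dec-true (k ∈? A) k∈A)

  exchangedRow-∈₂ : ∀ {A B k} → ¬ k ∈ A → k ∈ B → exchangedRow A B k ≡ ℕ.suc i
  exchangedRow-∈₂ {A} {B} {k} k∉A k∈B rewrite Dec.dec-false (k ∈? A) k∉A | Dec.dec-true (k ∈? B) k∈B = refl

  exchangedRow-∉ : ∀ {A B k} → ¬ k ∈ A → ¬ k ∈ B → exchangedRow A B k ≡ toℕ (rowOf S k)
  exchangedRow-∉ {A} {B} {k} k∉A k∉B rewrite Dec.dec-false (k ∈? A) k∉A | Dec.dec-false (k ∈? B) k∉B = refl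

-- A map f : Fin n → ℕ assigns a target row to each entry; exchangeCount f counts the exchanges
-- (A, B) indexing Ξ_{i,Q}(S) whose result places every entry k in row f k.
module ExchangeCount {n : ℕ} {λ′ : Partition n} (S : Numbering λ′) (i : ℕ) (Q : Subset n)
                     (Q-in-row : InRow S (ℕ.suc i) Q) where

  rowS : Fin n → ℕ
  rowS k = toℕ (rowOf S k)

  Movable : Fin n → Set
  Movable k = k ∈ Q ⊎ rowS k ≡ i

  movable? : ∀ k → Dec (Movable k)
  movable? k = (k ∈? Q) Dec.⊎-dec (rowS k ℕ.≟ i)

  AgreesOff : (Fin n → ℕ) → Set
  AgreesOff f = ∀ k → ¬ Movable k → f k ≡ rowS k

  agreesOff? : ∀ f → Dec (AgreesOff f)
  agreesOff? f = all? (λ k → Dec.¬? (movable? k) Dec.→-dec (f k ℕ.≟ rowS k))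

  TwoRowsOn : (Fin n → ℕ) → Set
  TwoRowsOn f = ∀ k → Movable k → f k ≡ i ⊎ f k ≡ ℕ.suc i

  twoRowsOn? : ∀ f → Dec (TwoRowsOn f)
  twoRowsOn? f = all? (λ k → movable? k Dec.→-dec ((f k ℕ.≟ i) Dec.⊎-dec (f k ℕ.≟ ℕ.suc i)))

  risen sunk : (Fin n → ℕ) → Subset n
  risen f = Vec.tabulate (λ k → does (k ∈? Q) ∧ does (f k ℕ.≟ i))
  sunk f = Vec.tabulate (λ k → does (rowS k ℕ.≟ i) ∧ does (f k ℕ.≟ ℕ.suc i))

  module _ (f : Fin n → ℕ) {k : Fin n} where

    ∈-risen⁺ : k ∈ Q → f k ≡ i → k ∈ risen f
    ∈-risen⁺ k∈Q fk≡i = ∈-tabulate⁺ (does-∧⁺ (k ∈? Q) (f k ℕ.≟ i) k∈Q fk≡i)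

    ∈-risen⁻ : k ∈ risen f → k ∈ Q × f k ≡ i
    ∈-risen⁻ k∈ = does-∧⁻ (k ∈? Q) (f k ℕ.≟ i) (∈-tabulate⁻ k∈)

    ∈-sunk⁺ : rowS k ≡ i → f k ≡ ℕ.suc i → k ∈ sunk f
    ∈-sunk⁺ row≡i fk≡1+i = ∈-tabulate⁺ (does-∧⁺ (rowS k ℕ.≟ i) (f k ℕ.≟ ℕ.suc i) row≡i fk≡1+i)

    ∈-sunk⁻ : k ∈ sunk f → rowS k ≡ i × f k ≡ ℕ.suc i
    ∈-sunk⁻ k∈ = does-∧⁻ (rowS k ℕ.≟ i) (f k ℕ.≟ ℕ.suc i) (∈-tabulate⁻ k∈)

  IsExchangeOf : (Fin n → ℕ) → Subset n → Subset n → Set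
  IsExchangeOf f A B = ∀ k → f k ≡ exchangedRow S i A B k

  isExchangeOf? : ∀ f A B → Dec (IsExchangeOf f A B)
  isExchangeOf? f A B = all? (λ k → f k ℕ.≟ exchangedRow S i A B k)

  module _ (f : Fin n → ℕ) {A B : Subset n} (A⊆Q : A ⊆ Q) (B-in-row : InRow S i B) (exch : IsExchangeOf f A B) where

    private
      ∉A-of-row-i : ∀ {k} → rowS k ≡ i → ¬ k ∈ A
      ∉A-of-row-i row≡i k∈A = ℕP.1+n≢n (trans (sym (Q-in-row _ (A⊆Q k∈A))) row≡i)

      ∉B-of-Q : ∀ {k} → k ∈ Q → ¬ k ∈ B
      ∉B-of-Q k∈Q k∈B = ℕP.1+n≢n (trans (sym (Q-in-row _ k∈Q)) (B-in-row _ k∈B))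

      unmoved : ∀ {k} → ¬ k ∈ A → ¬ k ∈ B → f k ≡ rowS k
      unmoved k∉A k∉B = trans (exch _) (exchangedRow-∉ S i k∉A k∉B)

    exchange-risen : A ≡ risen f
    exchange-risen = ⊆-antisym
      (λ k∈A → ∈-risen⁺ f (A⊆Q k∈A) (trans (exch _) (exchangedRow-∈₁ S i k∈A)))
      (λ {k} k∈risen → let k∈Q , fk≡i = ∈-risen⁻ f k∈risen in
        Dec.decidable-stable (k ∈? A) λ k∉A → ℕP.1+n≢n (trans (sym (Q-in-row k k∈Q)) (trans (sym (unmoved k∉A (∉B-of-Q k∈Q))) fk≡i)))

    exchange-sunk : B ≡ sunk f
    exchange-sunk = ⊆-antisym
      (λ {k} k∈B → ∈-sunk⁺ f (B-in-row k k∈B) (trans (exch k) (exchangedRow-∈₂ S i (∉A-of-row-i (B-in-row k k∈B)) k∈B)))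
      (λ {k} k∈sunk → let row≡i , fk≡1+i = ∈-sunk⁻ f k∈sunk in
        Dec.decidable-stable (k ∈? B) λ k∉B → ℕP.1+n≢n (trans (sym fk≡1+i) (trans (unmoved (∉A-of-row-i row≡i) k∉B) row≡i)))

    exchange-agreesOff : AgreesOff f
    exchange-agreesOff k k-fixed = unmoved (λ k∈A → k-fixed (inj₁ (A⊆Q k∈A))) (λ k∈B → k-fixed (inj₂ (B-in-row k k∈B)))

    exchange-twoRowsOn : TwoRowsOn f
    exchange-twoRowsOn k k-movable with k ∈? A | k ∈? B
    ... | yes k∈A | _ = inj₁ (trans (exch k) (exchangedRow-∈₁ S i k∈A))
    ... | no k∉A | yes k∈B = inj₂ (trans (exch k) (exchangedRow-∈₂ S i k∉A k∈B))
    ... | no k∉A | no k∉B with k-movable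
    ...   | inj₁ k∈Q = inj₂ (trans (unmoved k∉A k∉B) (Q-in-row k k∈Q))
    ...   | inj₂ row≡i = inj₁ (trans (unmoved k∉A k∉B) row≡i)

  isExchangeOf-risen-sunk : ∀ f → AgreesOff f → TwoRowsOn f → IsExchangeOf f (risen f) (sunk f)
  isExchangeOf-risen-sunk f agrees two-rows k = by-cases (k ∈? risen f) (k ∈? sunk f)
    where
    unchanged : ¬ k ∈ risen f → ¬ k ∈ sunk f → f k ≡ rowS k
    unchanged k∉risen k∉sunk with movable? k
    ... | no k-fixed = agrees k k-fixed
    ... | yes k-movable with k-movable | two-rows k k-movable
    ...   | inj₁ k∈Q | inj₁ fk≡i = ⊥-elim (k∉risen (∈-risen⁺ f k∈Q fk≡i))
    ...   | inj₁ k∈Q | inj₂ fk≡1+i = trans fk≡1+i (sym (Q-in-row k k∈Q))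
    ...   | inj₂ row≡i | inj₁ fk≡i = trans fk≡i (sym row≡i)
    ...   | inj₂ row≡i | inj₂ fk≡1+i = ⊥-elim (k∉sunk (∈-sunk⁺ f row≡i fk≡1+i))
    by-cases : Dec (k ∈ risen f) → Dec (k ∈ sunk f) → f k ≡ exchangedRow S i (risen f) (sunk f) k
    by-cases (yes k∈risen) _ = trans (proj₂ (∈-risen⁻ f k∈risen)) (sym (exchangedRow-∈₁ S i k∈risen))
    by-cases (no k∉risen) (yes k∈sunk) = trans (proj₂ (∈-sunk⁻ f k∈sunk)) (sym (exchangedRow-∈₂ S i k∉risen k∈sunk))
    by-cases (no k∉risen) (no k∉sunk) = trans (unchanged k∉risen k∉sunk) (sym (exchangedRow-∉ S i k∉risen k∉sunk))

  exchangeTerm : (Fin n → ℕ) → Subset n → Subset n → ℤ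
  exchangeTerm f A B = when (A ⊆? Q) (when (inRow? S i B) (when (∣ A ∣ ℕ.≟ ∣ B ∣) (when (isExchangeOf? f A B) 1ℤ)))

  exchangeCount : (Fin n → ℕ) → ℤ
  exchangeCount f = ∑ (allSubsets n) (λ A → ∑ (allSubsets n) (exchangeTerm f A))

  private
    exchangeTerm-support : ∀ f A B → ¬ (A ≡ risen f × B ≡ sunk f) → exchangeTerm f A B ≡ 0ℤ
    exchangeTerm-support f A B elsewhere = when³-zero (A ⊆? Q) (inRow? S i B) (∣ A ∣ ℕ.≟ ∣ B ∣)
      λ A⊆Q B-in-row _ → when-no (isExchangeOf? f A B)
        (λ exch → elsewhere (exchange-risen f A⊆Q B-in-row exch , exchange-sunk f A⊆Q B-in-row exch)) 1ℤ

    risen⊆Q : ∀ f → risen f ⊆ Q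
    risen⊆Q f k∈ = proj₁ (∈-risen⁻ f k∈)

    sunk-in-row : ∀ f → InRow S i (sunk f)
    sunk-in-row f k k∈ = proj₁ (∈-sunk⁻ f k∈)

  exchangeCount≡ : ∀ f → exchangeCount f ≡
    when (agreesOff? f) (when (twoRowsOn? f) (when (∣ risen f ∣ ℕ.≟ ∣ sunk f ∣) 1ℤ))
  exchangeCount≡ f = begin
    exchangeCount f
      ≡⟨ ∑-cong (allSubsets n) (λ A → ∑-supported _ (allSubsets-enumerates n) _ (sunk f)
           (λ B B≢sunk → exchangeTerm-support f A B (B≢sunk ∘ proj₂))) ⟩
    ∑ (allSubsets n) (λ A → exchangeTerm f A (sunk f))
      ≡⟨ ∑-supported _ (allSubsets-enumerates n) _ (risen f)
           (λ A A≢risen → exchangeTerm-support f A (sunk f) (A≢risen ∘ proj₁)) ⟩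
    exchangeTerm f (risen f) (sunk f)
      ≡⟨ trans (when-yes (risen f ⊆? Q) (risen⊆Q f) _) (when-yes (inRow? S i (sunk f)) (sunk-in-row f) _) ⟩
    when (∣ risen f ∣ ℕ.≟ ∣ sunk f ∣) (when (isExchangeOf? f (risen f) (sunk f)) 1ℤ)
      ≡⟨ regroup (∣ risen f ∣ ℕ.≟ ∣ sunk f ∣) (isExchangeOf? f (risen f) (sunk f)) (agreesOff? f) (twoRowsOn? f) ⟩
    when (agreesOff? f) (when (twoRowsOn? f) (when (∣ risen f ∣ ℕ.≟ ∣ sunk f ∣) 1ℤ)) ∎
    where
    open ≡-Reasoning
    regroup : (c : Dec _) (e : Dec (IsExchangeOf f (risen f) (sunk f))) (d₁ : Dec (AgreesOff f)) (d₂ : Dec (TwoRowsOn f)) →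
              when c (when e 1ℤ) ≡ when d₁ (when d₂ (when c 1ℤ))
    regroup c (yes exch) (yes _) (yes _) = refl
    regroup c (yes exch) (no ¬agrees) _ = ⊥-elim (¬agrees (exchange-agreesOff f (risen⊆Q f) (sunk-in-row f) exch))
    regroup c (yes exch) (yes _) (no ¬two) = ⊥-elim (¬two (exchange-twoRowsOn f (risen⊆Q f) (sunk-in-row f) exch))
    regroup c (no ¬exch) (yes agrees) (yes two) = ⊥-elim (¬exch (isExchangeOf-risen-sunk f agrees two))
    regroup c (no _) (yes _) (no _) = when-0 c
    regroup c (no _) (no _) _ = when-0 c

  exchangeCount-cong : ∀ {f f′} → (∀ k → f k ≡ f′ k) → exchangeCount f ≡ exchangeCount f′
  exchangeCount-cong {f} {f′} f≗f′ = ∑-cong (allSubsets n) λ A → ∑-cong (allSubsets n) λ B →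
    cong (when (A ⊆? Q) ∘ when (inRow? S i B) ∘ when (∣ A ∣ ℕ.≟ ∣ B ∣))
      (when-iff (isExchangeOf? f A B) (isExchangeOf? f′ A B) (λ e k → trans (sym (f≗f′ k)) (e k)) (λ e k → trans (f≗f′ k) (e k)) 1ℤ)

  stayCount : (Fin n → ℕ) → ℤ
  stayCount h = ∑ (allFin n) (λ k → 𝟙 (does (movable? k) ∧ does (h k ℕ.≟ i)))

  |rowᵢ| : ℤ
  |rowᵢ| = ∑ (allFin n) (λ k → 𝟙 (does (rowS k ℕ.≟ i)))

  -- Entry by entry: an entry of Q contributes [h k = i] to both sides, an entry of row i contributes 1.
  |risen|+|rowᵢ|≡|sunk|+stayCount : ∀ h → TwoRowsOn h → + ∣ risen h ∣ + |rowᵢ| ≡ + ∣ sunk h ∣ + stayCount h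
  |risen|+|rowᵢ|≡|sunk|+stayCount h two-rows =
    trans (cong (_+ |rowᵢ|) (∣∣≡∑ (risen h)))
    (trans (sym (∑-+ (allFin n) _ _))
    (trans (∑-cong (allFin n) pointwise)
    (trans (∑-+ (allFin n) _ _)
    (cong (_+ stayCount h) (sym (∣∣≡∑ (sunk h)))))))
    where
    pointwise : ∀ k → 𝟙 (does (k ∈? risen h)) + 𝟙 (does (rowS k ℕ.≟ i))
                    ≡ 𝟙 (does (k ∈? sunk h)) + 𝟙 (does (movable? k) ∧ does (h k ℕ.≟ i))
    pointwise k = trans (cong (λ x → 𝟙 x + 𝟙 (does (rowS k ℕ.≟ i))) (does-∈?-tabulate _ k))
                  (trans (by-cases (k ∈? Q) (rowS k ℕ.≟ i))
                         (cong (λ x → 𝟙 x + 𝟙 (does (movable? k) ∧ does (h k ℕ.≟ i))) (sym (does-∈?-tabulate _ k))))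
      where
      by-cases : (k∈?Q : Dec (k ∈ Q)) (row≟i : Dec (rowS k ≡ i)) →
        𝟙 (does k∈?Q ∧ does (h k ℕ.≟ i)) + 𝟙 (does row≟i)
          ≡ 𝟙 (does row≟i ∧ does (h k ℕ.≟ ℕ.suc i)) + 𝟙 (does (k∈?Q Dec.⊎-dec row≟i) ∧ does (h k ℕ.≟ i))
      by-cases (yes k∈Q) (yes row≡i) = ⊥-elim (ℕP.1+n≢n (trans (sym (Q-in-row k k∈Q)) row≡i))
      by-cases (yes _) (no _) = +-comm (𝟙 (does (h k ℕ.≟ i))) 0ℤ
      by-cases (no _) (no _) = refl
      by-cases (no _) (yes row≡i) with two-rows k (inj₂ row≡i)
      ... | inj₁ hk≡i rewrite hk≡i | Dec.dec-false (i ℕ.≟ ℕ.suc i) (ℕP.1+n≢n ∘ sym) | Dec.dec-true (i ℕ.≟ i) refl = refl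
      ... | inj₂ hk≡1+i rewrite hk≡1+i | Dec.dec-false (ℕ.suc i ℕ.≟ i) ℕP.1+n≢n | Dec.dec-true (ℕ.suc i ℕ.≟ ℕ.suc i) refl = refl

  |risen|≡|sunk|⇔stayCount≡|rowᵢ| : ∀ h → TwoRowsOn h → (∣ risen h ∣ ≡ ∣ sunk h ∣ → stayCount h ≡ |rowᵢ|) × (stayCount h ≡ |rowᵢ| → ∣ risen h ∣ ≡ ∣ sunk h ∣)
  |risen|≡|sunk|⇔stayCount≡|rowᵢ| h two-rows =
    (λ |risen|≡|sunk| → sym (∙-cancelˡ (+ ∣ sunk h ∣) |rowᵢ| (stayCount h)
       (trans (cong (λ z → + z + |rowᵢ|) (sym |risen|≡|sunk|)) balance))) ,
    (λ stay≡row → +-injective (∙-cancelʳ |rowᵢ| (+ ∣ risen h ∣) (+ ∣ sunk h ∣)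
       (trans balance (cong (_+_ (+ ∣ sunk h ∣)) stay≡row))))
    where
    balance = |risen|+|rowᵢ|≡|sunk|+stayCount h two-rows

  module _ (a b : Fin n) (a-movable : Movable a) (b-movable : Movable b) where

    private
      s : Fin n → Fin n
      s = PC.transpose a b

      s-fixed : ∀ k → ¬ Movable k → s k ≡ k
      s-fixed k k-fixed = transpose-cases a b k (λ k j → j ≡ k)
        (λ k≡a → ⊥-elim (k-fixed (subst Movable (sym k≡a) a-movable)))
        (λ _ k≡b → ⊥-elim (k-fixed (subst Movable (sym k≡b) b-movable)))
        (λ _ _ → refl)

      s-movable : ∀ k → Movable k → Movable (s k)
      s-movable k k-movable = transpose-cases a b k (λ _ j → Movable j) (λ _ → b-movable) (λ _ _ → a-movable) (λ _ _ → k-movable)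

      s-movable⁻ : ∀ k → Movable (s k) → Movable k
      s-movable⁻ k sk-movable = subst Movable (transpose-involutive a b k) (s-movable (s k) sk-movable)

    module _ (f : Fin n → ℕ) where

      private
        g : Fin n → ℕ
        g = f ∘ s

        agreesOff-g⇔f : (AgreesOff g → AgreesOff f) × (AgreesOff f → AgreesOff g)
        agreesOff-g⇔f = (λ agrees k k-fixed → trans (cong f (sym (s-fixed k k-fixed))) (agrees k k-fixed))
                      , (λ agrees k k-fixed → trans (cong f (s-fixed k k-fixed)) (agrees k k-fixed))

        twoRowsOn-g⇔f : (TwoRowsOn g → TwoRowsOn f) × (TwoRowsOn f → TwoRowsOn g)
        twoRowsOn-g⇔f = (λ two k k-movable → subst (λ z → f z ≡ i ⊎ f z ≡ ℕ.suc i) (transpose-involutive a b k) (two (s k) (s-movable k k-movable)))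
                      , (λ two k k-movable → two (s k) (s-movable k k-movable))

        stayCount-g≡f : stayCount g ≡ stayCount f
        stayCount-g≡f =
          trans (∑-cong (allFin n) (λ k → cong (λ x → 𝟙 (x ∧ does (g k ℕ.≟ i)))
                   (does-iff (movable? k) (movable? (s k)) (s-movable k) (s-movable⁻ k))))
          (∑-reindex FinP._≟_ (allFin-enumerates n) s s (transpose-involutive a b) (transpose-involutive a b)
             (λ k → 𝟙 (does (movable? k) ∧ does (f k ℕ.≟ i))))

        cardinalities-g⇔f : TwoRowsOn g → TwoRowsOn f →
          (∣ risen g ∣ ≡ ∣ sunk g ∣ → ∣ risen f ∣ ≡ ∣ sunk f ∣) × (∣ risen f ∣ ≡ ∣ sunk f ∣ → ∣ risen g ∣ ≡ ∣ sunk g ∣)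
        cardinalities-g⇔f two-g two-f =
          (λ e → proj₂ (|risen|≡|sunk|⇔stayCount≡|rowᵢ| f two-f) (trans (sym stayCount-g≡f) (proj₁ (|risen|≡|sunk|⇔stayCount≡|rowᵢ| g two-g) e))) ,
          (λ e → proj₂ (|risen|≡|sunk|⇔stayCount≡|rowᵢ| g two-g) (trans stayCount-g≡f (proj₁ (|risen|≡|sunk|⇔stayCount≡|rowᵢ| f two-f) e)))

      exchangeCount-∘transpose : exchangeCount (f ∘ PC.transpose a b) ≡ exchangeCount f
      exchangeCount-∘transpose =
        trans (exchangeCount≡ g)
        (trans (by-cases (agreesOff? g) (agreesOff? f) (twoRowsOn? g) (twoRowsOn? f))
        (sym (exchangeCount≡ f)))
        where
        by-cases : (ag : Dec (AgreesOff g)) (af : Dec (AgreesOff f)) (tg : Dec (TwoRowsOn g)) (tf : Dec (TwoRowsOn f)) →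
          when ag (when tg (when (∣ risen g ∣ ℕ.≟ ∣ sunk g ∣) 1ℤ)) ≡ when af (when tf (when (∣ risen f ∣ ℕ.≟ ∣ sunk f ∣) 1ℤ))
        by-cases (no _) (no _) _ _ = refl
        by-cases (yes ag) (no ¬af) _ _ = ⊥-elim (¬af (proj₁ agreesOff-g⇔f ag))
        by-cases (no ¬ag) (yes af) _ _ = ⊥-elim (¬ag (proj₂ agreesOff-g⇔f af))
        by-cases (yes _) (yes _) (no _) (no _) = refl
        by-cases (yes _) (yes _) (yes tg) (no ¬tf) = ⊥-elim (¬tf (proj₁ twoRowsOn-g⇔f tg))
        by-cases (yes _) (yes _) (no ¬tg) (yes tf) = ⊥-elim (¬tg (proj₂ twoRowsOn-g⇔f tf))
        by-cases (yes _) (yes _) (yes tg) (yes tf) =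
          uncurry (when-iff (∣ risen g ∣ ℕ.≟ ∣ sunk g ∣) (∣ risen f ∣ ℕ.≟ ∣ sunk f ∣)) (cardinalities-g⇔f tg tf) 1ℤ

module CoefficientOfγ {n : ℕ} {λ′ : Partition n} (T S : Numbering λ′) (i : ℕ) (Q : Subset n)
                      (Q-in-row : InRow S (ℕ.suc i) Q) where

  open ExchangeCount S i Q Q-in-row

  rowsᵀ : Tab n → Fin n → ℕ
  rowsᵀ u k = toℕ (rowOf T (vlookup u k))

  private
    rowsMatch⇔isExchange : ∀ u A B → A ⊆ Q → InRow S i B → ∣ A ∣ ≡ ∣ B ∣ →
      (RowsMatch T (exchange S i A B) u → IsExchangeOf (rowsᵀ u) A B) × (IsExchangeOf (rowsᵀ u) A B → RowsMatch T (exchange S i A B) u)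
    rowsMatch⇔isExchange u A B A⊆Q B-in-row |A|≡|B| =
      (λ match k → trans (cong toℕ (match k)) (rows k)) ,
      (λ exch k → FinP.toℕ-injective (trans (exch k) (sym (rows k))))
      where
      rows = rowOf-exchange S i A B (λ k k∈A → Q-in-row k (A⊆Q k∈A)) B-in-row |A|≡|B|

    term≡ : ∀ u A B →
      when (A ⊆? Q) (when (inRow? S i B) (when (∣ A ∣ ℕ.≟ ∣ B ∣) (coeff (⟦ σ (exchange S i A B) T ⟧ * a (exchange S i A B)) u)))
        ≡ when (isPerm? u) (exchangeTerm (rowsᵀ u) A B)
    term≡ u A B = trans (cong (when (A ⊆? Q) ∘ when (inRow? S i B) ∘ when (∣ A ∣ ℕ.≟ ∣ B ∣)) (coeff-σa (exchange S i A B) T u))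
                        (by-cases (A ⊆? Q) (inRow? S i B) (∣ A ∣ ℕ.≟ ∣ B ∣))
      where
      U = exchange S i A B
      by-cases : (A⊆?Q : Dec (A ⊆ Q)) (B? : Dec (InRow S i B)) (|A|≟|B| : Dec (∣ A ∣ ≡ ∣ B ∣)) →
        when A⊆?Q (when B? (when |A|≟|B| (when (isPerm? u) (when (rowsMatch? T U u) 1ℤ))))
          ≡ when (isPerm? u) (when A⊆?Q (when B? (when |A|≟|B| (when (isExchangeOf? (rowsᵀ u) A B) 1ℤ))))
      by-cases (no _) _ _ = sym (when-0 (isPerm? u))
      by-cases (yes _) (no _) _ = sym (when-0 (isPerm? u))
      by-cases (yes _) (yes _) (no _) = sym (when-0 (isPerm? u))
      by-cases (yes A⊆Q) (yes B-in-row) (yes |A|≡|B|) =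
        cong (when (isPerm? u)) (uncurry (when-iff (rowsMatch? T U u) (isExchangeOf? (rowsᵀ u) A B))
                                   (rowsMatch⇔isExchange u A B A⊆Q B-in-row |A|≡|B|) 1ℤ)

  coeff-γ : ∀ u → coeff (γ T S i Q) u ≡ when (isPerm? u) (exchangeCount (rowsᵀ u))
  coeff-γ u = begin
    coeff (γ T S i Q) u
      ≡⟨ coeff-concatMap _ (Ξ S i Q) u ⟩
    ∑ (Ξ S i Q) F
      ≡⟨ ∑-map _ (ΞIndex S i Q) F ⟩
    ∑ (ΞIndex S i Q) (F ∘ uncurry (exchange S i))
      ≡⟨ ∑-filter _ (cartesianProduct Qsubsets rowSubsets) _ ⟩
    ∑ (cartesianProduct Qsubsets rowSubsets) (λ (A , B) → when (∣ A ∣ ℕ.≟ ∣ B ∣) (F (exchange S i A B)))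
      ≡⟨ ∑-cartesianProduct Qsubsets rowSubsets _ ⟩
    ∑ Qsubsets (λ A → ∑ rowSubsets (λ B → when (∣ A ∣ ℕ.≟ ∣ B ∣) (F (exchange S i A B))))
      ≡⟨ ∑-filter (_⊆? Q) (allSubsets n) _ ⟩
    ∑ (allSubsets n) (λ A → when (A ⊆? Q) (∑ rowSubsets (λ B → when (∣ A ∣ ℕ.≟ ∣ B ∣) (F (exchange S i A B)))))
      ≡⟨ ∑-cong (allSubsets n) (λ A → cong (when (A ⊆? Q)) (∑-filter (inRow? S i) (allSubsets n) _)) ⟩
    ∑ (allSubsets n) (λ A → when (A ⊆? Q) (∑ (allSubsets n) (λ B → when (inRow? S i B) (when (∣ A ∣ ℕ.≟ ∣ B ∣) (F (exchange S i A B))))))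
      ≡⟨ ∑-cong (allSubsets n) (λ A → sym (∑-when (A ⊆? Q) (allSubsets n) _)) ⟩
    ∑ (allSubsets n) (λ A → ∑ (allSubsets n) (λ B → when (A ⊆? Q) (when (inRow? S i B) (when (∣ A ∣ ℕ.≟ ∣ B ∣) (F (exchange S i A B))))))
      ≡⟨ ∑-cong (allSubsets n) (λ A → ∑-cong (allSubsets n) (term≡ u A)) ⟩
    ∑ (allSubsets n) (λ A → ∑ (allSubsets n) (λ B → when (isPerm? u) (exchangeTerm (rowsᵀ u) A B)))
      ≡⟨ ∑-cong (allSubsets n) (λ A → ∑-when (isPerm? u) (allSubsets n) _) ⟩
    ∑ (allSubsets n) (λ A → when (isPerm? u) (∑ (allSubsets n) (exchangeTerm (rowsᵀ u) A)))
      ≡⟨ ∑-when (isPerm? u) (allSubsets n) _ ⟩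
    when (isPerm? u) (exchangeCount (rowsᵀ u)) ∎
    where
    open ≡-Reasoning
    F : Numbering λ′ → ℤ
    F U = coeff (⟦ σ U T ⟧ * a U) u
    Qsubsets rowSubsets : List (Subset n)
    Qsubsets = filter (_⊆? Q) (allSubsets n)
    rowSubsets = filter (inRow? S i) (allSubsets n)

-- Cancellation by a sign-reversing involution

module Cancellation {n : ℕ} {λ′ : Partition n} (S T : Numbering λ′) (i : ℕ) (Q : Subset n)
                    (Q-in-row : InRow S (ℕ.suc i) Q) (Q-nonempty : Nonempty Q) where

  open ExchangeCount S i Q Q-in-row
  open CoefficientOfγ T S i Q Q-in-row

  β Γ : Tab n → ℤ
  β w = coeff (b T) w
  Γ u = coeff (γ T S i Q) u

  HitsMovable : Tab n → Fin n → Set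
  HitsMovable u j = ∃ λ k → Movable k × vlookup u k ≡ j

  hitsMovable? : ∀ u j → Dec (HitsMovable u j)
  hitsMovable? u j = FinP.any? (λ k → movable? k Dec.×-dec (vlookup u k FinP.≟ j))

  Swappable : Tab n → Fin n × Fin n → Set
  Swappable u (x , y) = colOf T x ≡ colOf T y × toℕ (rowOf T x) ≡ i × toℕ (rowOf T y) ≡ ℕ.suc i
                      × HitsMovable u x × HitsMovable u y

  swappable? : ∀ u p → Dec (Swappable u p)
  swappable? u (x , y) = (colOf T x ℕ.≟ colOf T y) Dec.×-dec (toℕ (rowOf T x) ℕ.≟ i) Dec.×-dec
    (toℕ (rowOf T y) ℕ.≟ ℕ.suc i) Dec.×-dec hitsMovable? u x Dec.×-dec hitsMovable? u y

  pairs : List (Fin n × Fin n)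
  pairs = cartesianProduct (allFin n) (allFin n)

  firstSwap : Tab n → Maybe (Fin n × Fin n)
  firstSwap u = List.find (swappable? u) pairs

  swappable⇒distinct : ∀ {u x y} → Swappable u (x , y) → ¬ x ≡ y
  swappable⇒distinct (_ , row-x , row-y , _) x≡y =
    ℕP.<-irrefl (trans (sym row-x) (trans (cong (toℕ ∘ rowOf T) x≡y) row-y)) (ℕP.n<1+n i)

  -- The cancelling partner of a term (w , u): move the transposition of the first swappable pair from u to w.
  swapAlong : Maybe (Fin n × Fin n) → Tab n × Tab n → Tab n × Tab n
  swapAlong nothing wu = wu
  swapAlong (just (x , y)) (w , u) = w ∘t ⦅ x ⇄ y ⦆ , ⦅ x ⇄ y ⦆ ∘t u

  partner : Tab n × Tab n → Tab n × Tab n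
  partner (w , u) = swapAlong (firstSwap u) (w , u)

  hitsMovable-⦅⇄⦆∘ : ∀ {x y u} → HitsMovable u x → HitsMovable u y → ∀ j →
    (HitsMovable (⦅ x ⇄ y ⦆ ∘t u) j → HitsMovable u j) × (HitsMovable u j → HitsMovable (⦅ x ⇄ y ⦆ ∘t u) j)
  hitsMovable-⦅⇄⦆∘ {x} {y} {u} hit-x@(kx , kx-movable , ukx≡x) hit-y@(ky , ky-movable , uky≡y) j = to , from
    where
    to : HitsMovable (⦅ x ⇄ y ⦆ ∘t u) j → HitsMovable u j
    to (k , k-movable , e) = transpose-cases x y j (λ j _ → HitsMovable u j)
      (λ j≡x → subst (HitsMovable u) (sym j≡x) hit-x)
      (λ _ j≡y → subst (HitsMovable u) (sym j≡y) hit-y)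
      (λ j≢x j≢y → k , k-movable , trans (sym (transpose-involutive x y (vlookup u k)))
        (trans (cong (PC.transpose x y) (trans (sym (⦅⇄⦆-∘-lookup x y u k)) e)) (transpose-fix x y j j≢x j≢y)))
    from : HitsMovable u j → HitsMovable (⦅ x ⇄ y ⦆ ∘t u) j
    from (k , k-movable , e) = transpose-cases x y j (λ j _ → HitsMovable (⦅ x ⇄ y ⦆ ∘t u) j)
      (λ j≡x → ky , ky-movable , trans (⦅⇄⦆-∘-lookup x y u ky) (trans (cong (PC.transpose x y) uky≡y) (trans (transpose-at₂ x y) (sym j≡x))))
      (λ _ j≡y → kx , kx-movable , trans (⦅⇄⦆-∘-lookup x y u kx) (trans (cong (PC.transpose x y) ukx≡x) (trans (transpose-at₁ x y) (sym j≡y))))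
      (λ j≢x j≢y → k , k-movable , trans (⦅⇄⦆-∘-lookup x y u k) (trans (cong (PC.transpose x y) e) (transpose-fix x y j j≢x j≢y)))

  firstSwap-⦅⇄⦆∘ : ∀ {x y u} → Swappable u (x , y) → firstSwap (⦅ x ⇄ y ⦆ ∘t u) ≡ firstSwap u
  firstSwap-⦅⇄⦆∘ {x} {y} {u} (_ , _ , _ , hit-x , hit-y) = find-cong (swappable? (⦅ x ⇄ y ⦆ ∘t u)) (swappable? u)
    (λ (x′ , y′) (c , r , r′ , h , h′) → c , r , r′ , proj₁ (hits x′) h , proj₁ (hits y′) h′)
    (λ (x′ , y′) (c , r , r′ , h , h′) → c , r , r′ , proj₂ (hits x′) h , proj₂ (hits y′) h′)
    pairs
    where hits = hitsMovable-⦅⇄⦆∘ {x} {y} {u} hit-x hit-y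

  partner-involutive : ∀ wu → partner (partner wu) ≡ wu
  partner-involutive (w , u) = by-cases (firstSwap u) refl
    where
    by-cases : ∀ m → firstSwap u ≡ m → partner (partner (w , u)) ≡ (w , u)
    by-cases nothing first = trans (cong partner (cong (λ m → swapAlong m (w , u)) first))
                                   (cong (λ m → swapAlong m (w , u)) first)
    by-cases (just (x , y)) first = begin
      partner (partner (w , u))
        ≡⟨ cong partner (cong (λ m → swapAlong m (w , u)) first) ⟩
      partner (w ∘t ⦅ x ⇄ y ⦆ , ⦅ x ⇄ y ⦆ ∘t u)
        ≡⟨ cong (λ m → swapAlong m (w ∘t ⦅ x ⇄ y ⦆ , ⦅ x ⇄ y ⦆ ∘t u))
                (trans (firstSwap-⦅⇄⦆∘ {x} {y} {u} (find-sound (swappable? u) pairs first)) first) ⟩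
      ((w ∘t ⦅ x ⇄ y ⦆) ∘t ⦅ x ⇄ y ⦆ , ⦅ x ⇄ y ⦆ ∘t (⦅ x ⇄ y ⦆ ∘t u))
        ≡⟨ cong₂ _,_ (∘⦅⇄⦆-cancel x y w) (⦅⇄⦆-∘-cancel x y u) ⟩
      (w , u) ∎
      where open ≡-Reasoning

  β-∘⦅⇄⦆ : ∀ {x y} (w : Tab n) → colOf T x ≡ colOf T y → ¬ x ≡ y → β (w ∘t ⦅ x ⇄ y ⦆) ≡ - β w
  β-∘⦅⇄⦆ {x} {y} w same-col x≢y =
    trans (coeff-b T w′) (trans (by-cases (isPerm? w)) (cong -_ (sym (coeff-b T w))))
    where
    w′ = w ∘t ⦅ x ⇄ y ⦆
    col-preserved : ∀ k → colOf T (PC.transpose x y k) ≡ colOf T k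
    col-preserved k = transpose-cases x y k (λ k j → colOf T j ≡ colOf T k)
      (λ k≡x → trans (sym same-col) (cong (colOf T) (sym k≡x))) (λ _ k≡y → trans same-col (cong (colOf T) (sym k≡y))) (λ _ _ → refl)
    w′-lookup : ∀ k → vlookup w′ k ≡ vlookup w (PC.transpose x y k)
    w′-lookup k = trans (lookup-∘t w ⦅ x ⇄ y ⦆ k) (cong (vlookup w) (lookup-⦅⇄⦆ x y k))
    InC-w′⇔w : (InC T w′ → InC T w) × (InC T w → InC T w′)
    InC-w′⇔w =
      (λ c k → trans (cong (colOf T ∘ vlookup w) (sym (transpose-involutive x y k)))
               (trans (cong (colOf T) (sym (w′-lookup (PC.transpose x y k)))) (trans (c _) (col-preserved k)))) ,
      (λ c k → trans (cong (colOf T) (w′-lookup k)) (trans (c _) (col-preserved k)))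
    by-cases : Dec (IsPerm w) → when (isPerm? w′) (when (InC? T w′) (sgn w′)) ≡ - when (isPerm? w) (when (InC? T w) (sgn w))
    by-cases (yes w-perm) = begin
      when (isPerm? w′) (when (InC? T w′) (sgn w′))  ≡⟨ when-yes (isPerm? w′) (IsPerm-∘ {π = w} {⦅ x ⇄ y ⦆} w-perm (⦅⇄⦆-isPerm x y)) _ ⟩
      when (InC? T w′) (sgn w′)                      ≡⟨ uncurry (when-iff (InC? T w′) (InC? T w)) InC-w′⇔w _ ⟩
      when (InC? T w) (sgn w′)                       ≡⟨ cong (when (InC? T w)) (sgn-∘⦅⇄⦆ w x y w-perm x≢y) ⟩
      when (InC? T w) (- sgn w)                      ≡⟨ when-neg (InC? T w) (sgn w) ⟩
      - when (InC? T w) (sgn w)                      ≡⟨ cong -_ (when-yes (isPerm? w) w-perm _) ⟨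
      - when (isPerm? w) (when (InC? T w) (sgn w))   ∎
      where open ≡-Reasoning
    by-cases (no ¬w-perm) = trans (when-no (isPerm? w′) (¬w-perm ∘ IsPerm-∘⁻ˡ {π = w} (⦅⇄⦆-self-inverse x y)) _)
                                  (cong -_ (sym (when-no (isPerm? w) ¬w-perm _)))

  Γ-⦅⇄⦆∘ : ∀ {x y u} → Swappable u (x , y) → Γ (⦅ x ⇄ y ⦆ ∘t u) ≡ Γ u
  Γ-⦅⇄⦆∘ {x} {y} {u} (_ , _ , _ , (kx , kx-movable , ukx≡x) , (ky , ky-movable , uky≡y)) =
    trans (coeff-γ (⦅ x ⇄ y ⦆ ∘t u)) (trans (by-cases (isPerm? u)) (sym (coeff-γ u)))
    where
    by-cases : Dec (IsPerm u) → when (isPerm? (⦅ x ⇄ y ⦆ ∘t u)) (exchangeCount (rowsᵀ (⦅ x ⇄ y ⦆ ∘t u)))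
                                ≡ when (isPerm? u) (exchangeCount (rowsᵀ u))
    by-cases (no ¬u-perm) = trans (when-no (isPerm? (⦅ x ⇄ y ⦆ ∘t u)) (¬u-perm ∘ IsPerm-∘⁻ʳ {π = ⦅ x ⇄ y ⦆} {u}) _)
                                  (sym (when-no (isPerm? u) ¬u-perm _))
    by-cases (yes u-perm) =
      trans (when-yes (isPerm? (⦅ x ⇄ y ⦆ ∘t u)) (IsPerm-∘ {π = ⦅ x ⇄ y ⦆} {u} (⦅⇄⦆-isPerm x y) u-perm) _)
      (trans (exchangeCount-cong (λ k → cong (toℕ ∘ rowOf T) (lookup-swapped k)))
      (trans (exchangeCount-∘transpose kx ky kx-movable ky-movable (rowsᵀ u))
      (sym (when-yes (isPerm? u) u-perm _))))
      where
      -- Moving x ⇄ y across u turns it into the transposition of the movable positions kx, ky.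
      lookup-swapped : ∀ k → vlookup (⦅ x ⇄ y ⦆ ∘t u) k ≡ vlookup u (PC.transpose kx ky k)
      lookup-swapped k = trans (⦅⇄⦆-∘-lookup x y u k) (transpose-cases kx ky k (λ k j → PC.transpose x y (vlookup u k) ≡ vlookup u j)
        (λ k≡kx → trans (cong (PC.transpose x y ∘ vlookup u) k≡kx) (trans (cong (PC.transpose x y) ukx≡x) (trans (transpose-at₁ x y) (sym uky≡y))))
        (λ _ k≡ky → trans (cong (PC.transpose x y ∘ vlookup u) k≡ky) (trans (cong (PC.transpose x y) uky≡y) (trans (transpose-at₂ x y) (sym ukx≡x))))
        (λ k≢kx k≢ky → transpose-fix x y (vlookup u k) (λ e → k≢kx (u-perm k kx (trans e (sym ukx≡x))))
                                                       (λ e → k≢ky (u-perm k ky (trans e (sym uky≡y))))))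

  module _ (u : Tab n) (u-perm : IsPerm u) (agrees : AgreesOff (rowsᵀ u)) (two-rows : TwoRowsOn (rowsᵀ u))
           (balanced : ∣ risen (rowsᵀ u) ∣ ≡ ∣ sunk (rowsᵀ u) ∣) where

    private
      f : Fin n → ℕ
      f = rowsᵀ u

      sinking : ∃ λ k → Movable k × f k ≡ ℕ.suc i
      sinking = from (proj₂ Q-nonempty)
        where
        from : ∀ {q} → q ∈ Q → ∃ λ k → Movable k × f k ≡ ℕ.suc i
        from {q} q∈Q with two-rows q (inj₁ q∈Q)
        ... | inj₂ fq≡1+i = q , inj₁ q∈Q , fq≡1+i
        ... | inj₁ fq≡i with nonempty? (sunk f)
        ...   | yes (k , k∈sunk) = k , inj₂ (proj₁ (∈-sunk⁻ f k∈sunk)) , proj₂ (∈-sunk⁻ f k∈sunk)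
        ...   | no sunk-empty = ⊥-elim (ℕP.<-irrefl (sym (trans balanced (trans (cong ∣_∣ (Empty-unique sunk-empty)) (∣⊥∣≡0 n))))
                                  (ℕP.≤-<-trans ℕ.z≤n (x∈p⇒∣p-x∣<∣p∣ (∈-risen⁺ f q∈Q fq≡i))))

      y : Fin n
      y = vlookup u (proj₁ sinking)

      row-y : toℕ (rowOf T y) ≡ ℕ.suc i
      row-y = proj₂ (proj₂ sinking)

      i<ℓ : i ℕ.< ℓ λ′
      i<ℓ = ℕP.<-trans (ℕP.n<1+n i) (subst (ℕ._< ℓ λ′) row-y (FinP.toℕ<n (rowOf T y)))

      rᵢ : Fin (ℓ λ′)
      rᵢ = Fin.fromℕ< i<ℓ

      -- Row i of the diagram is at least as long as row i+1, so the cell above y exists.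
      column-fits : colOf T y ℕ.< List.lookup (parts λ′) rᵢ
      column-fits = ℕP.<-≤-trans (FinP.toℕ<n (proj₂ (pos T y)))
        (Linked-lookup (weakDecr λ′) rᵢ (rowOf T y) (trans row-y (cong ℕ.suc (sym (FinP.toℕ-fromℕ< i<ℓ)))))

      x : Fin n
      x = entry T (rᵢ , Fin.fromℕ< column-fits)

      pos-x : pos T x ≡ (rᵢ , Fin.fromℕ< column-fits)
      pos-x = pos-entry T _

      x-hits : HitsMovable u x
      x-hits with IsPerm⇒surjective u u-perm x
      ... | k , uk≡x = k , k-movable , uk≡x
        where
        fk≡i : f k ≡ i
        fk≡i = trans (cong (toℕ ∘ rowOf T) uk≡x) (trans (cong (toℕ ∘ proj₁) pos-x) (FinP.toℕ-fromℕ< i<ℓ))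
        k-movable : Movable k
        k-movable with movable? k
        ... | yes m = m
        ... | no k-fixed = ⊥-elim (k-fixed (inj₂ (trans (sym (agrees k k-fixed)) fk≡i)))

    swappable-exists : ∃ λ p → p ∈ₗ pairs × Swappable u p
    swappable-exists = (x , y) , ∈-cartesianProduct⁺ (∈-allFin x) (∈-allFin y) ,
      trans (cong (toℕ ∘ proj₂) pos-x) (FinP.toℕ-fromℕ< column-fits) ,
      trans (cong (toℕ ∘ proj₁) pos-x) (FinP.toℕ-fromℕ< i<ℓ) ,
      row-y , x-hits , (proj₁ sinking , proj₁ (proj₂ sinking) , refl)

  Γ-vanishes : ∀ u → firstSwap u ≡ nothing → Γ u ≡ 0ℤ
  Γ-vanishes u none = trans (coeff-γ u) (by-cases (isPerm? u))
    where
    f = rowsᵀ u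
    by-cases : Dec (IsPerm u) → when (isPerm? u) (exchangeCount f) ≡ 0ℤ
    by-cases (no ¬u-perm) = when-no (isPerm? u) ¬u-perm _
    by-cases (yes u-perm) = trans (when-yes (isPerm? u) u-perm _) (trans (exchangeCount≡ f)
                              (when³-zero (agreesOff? f) (twoRowsOn? f) (∣ risen f ∣ ℕ.≟ ∣ sunk f ∣)
                                 λ agrees two-rows balanced → ⊥-elim let p , p∈pairs , p-swappable = swappable-exists u u-perm agrees two-rows balanced in
                                   find-complete (swappable? u) p∈pairs p-swappable none))

  module _ (v : Tab n) where

    private
      F : Tab n × Tab n → ℤ
      F (w , u) = β w ℤ.* (Γ u ℤ.* δ (w ∘t u) v)

      F-partner : ∀ wu → F (partner wu) ≡ - F wu
      F-partner (w , u) = by-cases (firstSwap u) refl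
        where
        by-cases : ∀ m → firstSwap u ≡ m → F (partner (w , u)) ≡ - F (w , u)
        by-cases nothing none = trans (cong (λ m → F (swapAlong m (w , u))) none) (trans F≡0 (cong -_ (sym F≡0)))
          where
          F≡0 : F (w , u) ≡ 0ℤ
          F≡0 = trans (cong (λ g → β w ℤ.* (g ℤ.* δ (w ∘t u) v)) (Γ-vanishes u none)) (*-zeroʳ (β w))
        by-cases (just (x , y)) first = begin
          F (partner (w , u))
            ≡⟨ cong (λ m → F (swapAlong m (w , u))) first ⟩
          β (w ∘t ⦅ x ⇄ y ⦆) ℤ.* (Γ (⦅ x ⇄ y ⦆ ∘t u) ℤ.* δ ((w ∘t ⦅ x ⇄ y ⦆) ∘t (⦅ x ⇄ y ⦆ ∘t u)) v)
            ≡⟨ cong₂ ℤ._*_ (β-∘⦅⇄⦆ w same-col (swappable⇒distinct {u} swappable))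
                           (cong₂ ℤ._*_ (Γ-⦅⇄⦆∘ swappable) (cong (λ t → δ t v) cancel)) ⟩
          - β w ℤ.* (Γ u ℤ.* δ (w ∘t u) v)
            ≡⟨ neg-distribˡ-* (β w) _ ⟨
          - F (w , u) ∎
          where
          open ≡-Reasoning
          swappable : Swappable u (x , y)
          swappable = find-sound (swappable? u) pairs first
          same-col : colOf T x ≡ colOf T y
          same-col = proj₁ swappable
          cancel : (w ∘t ⦅ x ⇄ y ⦆) ∘t (⦅ x ⇄ y ⦆ ∘t u) ≡ w ∘t u
          cancel = tab-ext λ k → begin
            vlookup ((w ∘t ⦅ x ⇄ y ⦆) ∘t (⦅ x ⇄ y ⦆ ∘t u)) k          ≡⟨ lookup-∘t (w ∘t ⦅ x ⇄ y ⦆) (⦅ x ⇄ y ⦆ ∘t u) k ⟩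
            vlookup (w ∘t ⦅ x ⇄ y ⦆) (vlookup (⦅ x ⇄ y ⦆ ∘t u) k)     ≡⟨ cong (vlookup (w ∘t ⦅ x ⇄ y ⦆)) (lookup-∘t ⦅ x ⇄ y ⦆ u k) ⟩
            vlookup (w ∘t ⦅ x ⇄ y ⦆) (vlookup ⦅ x ⇄ y ⦆ (vlookup u k)) ≡⟨ lookup-∘t w ⦅ x ⇄ y ⦆ _ ⟩
            vlookup w (vlookup ⦅ x ⇄ y ⦆ (vlookup ⦅ x ⇄ y ⦆ (vlookup u k)))
                                                                       ≡⟨ cong (vlookup w) (AreInverse.left-inverse (⦅⇄⦆-self-inverse x y) _) ⟩
            vlookup w (vlookup u k)                                    ≡⟨ lookup-∘t w u k ⟨
            vlookup (w ∘t u) k                                         ∎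

      allPairs : List (Tab n × Tab n)
      allPairs = cartesianProduct (allVecs n) (allVecs n)

      ∑F≡0 : ∑ allPairs F ≡ 0ℤ
      ∑F≡0 = self-negative (trans (sym (∑-reindex (_≟T_ ≟× _≟T_) all-enumerated partner partner partner-involutive partner-involutive F))
                           (trans (∑-cong allPairs F-partner) (∑-neg allPairs F)))
        where
        all-enumerated = cartesianProduct-enumerates _≟T_ _≟T_ (allVecs-enumerates n) (allVecs-enumerates n)
        self-negative : ∀ {z} → z ≡ - z → z ≡ 0ℤ
        self-negative {+ ℕ.zero} _ = refl
        self-negative {+ ℕ.suc _} ()
        self-negative { -[1+ _ ]} ()

    b*γ≡0 : coeff (b T * (a T * γ-cofactor T S i Q)) v ≡ 0ℤ
    b*γ≡0 = begin
      coeff (b T * (a T * γ-cofactor T S i Q)) v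
        ≡⟨ coeff-*-convolution (b T) _ v ⟩
      ∑ (allVecs n) (λ w → β w ℤ.* ∑ (allVecs n) (λ u → coeff (a T * γ-cofactor T S i Q) u ℤ.* δ (w ∘t u) v))
        ≡⟨ ∑-cong (allVecs n) (λ w → cong (β w ℤ.*_) (∑-cong (allVecs n) (λ u →
             cong (ℤ._* δ (w ∘t u) v) (sym (γ≈a*cofactor T S i Q u))))) ⟩
      ∑ (allVecs n) (λ w → β w ℤ.* ∑ (allVecs n) (λ u → Γ u ℤ.* δ (w ∘t u) v))
        ≡⟨ ∑-cong (allVecs n) (λ w → sym (∑-*ˡ (allVecs n) (β w) _)) ⟩
      ∑ (allVecs n) (λ w → ∑ (allVecs n) (λ u → F (w , u)))
        ≡⟨ ∑-cartesianProduct (allVecs n) (allVecs n) F ⟨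
      ∑ allPairs F
        ≡⟨ ∑F≡0 ⟩
      0ℤ ∎
      where open ≡-Reasoning

lemma2p16 : ∀ {n : ℕ} {λ′ : Partition n} (S T : Numbering λ′) (i : ℕ) (Q : Subset n) →
    suc i < ℓ λ′ → InRow S (suc i) Q → Nonempty Q →
    InKerΨ T (γ T S i Q)
lemma2p16 S T i Q _ Q-in-row Q-nonempty =
  γ-cofactor T S i Q , γ≈a*cofactor T S i Q , Cancellation.b*γ≡0 S T i Q Q-in-row Q-nonempty
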